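{- Let $K$ be a field of characteristic $0$ and $\mathbf{x}=x_1,x_2,\dots$ variables. In the algebra $\bigoplus_{n\ge0}K[[x_1,\dots,x_n]]S_n$ with product $\star$, the element \[ \Theta(\mathbf{x})=\sum_{n\ge0}\sum_{\sigma\in S_n}\frac{\prod_{j\in D(\sigma)}x_{\sigma(1)}x_{\sigma(2)}\cdots x_{\sigma(j)}}{\prod_{i=1}^{n}(1-x_{\sigma(1)}x_{\sigma(2)}\cdots x_{\sigma(i)})}\,\sigma \] satisfies \[ \Theta(\mathbf{x})=\cdots\star F(2)\star F(1)\star F(0),\qquad F(m)=\varepsilon+x_1^m\,1+x_1^mx_2^m\,12+x_1^mx_2^mx_3^m\,123+\cdots, \] where the infinite product is expanded from right to left.
   Context: For $\sigma\in S_n$ (written as the word $\sigma(1)\cdots\sigma(n)$), $D(\sigma)=\{j:1\le j\le n-1,\ \sigma(j)>\sigma(j+1)\}$; $\varepsilon$ is the unique element of $S_0$, and $12\cdots a$ denotes the identity of $S_a$. Elements of $\bigoplus_{n\ge0}K[[x_1,\dots,x_n]]S_n$ are (possibly infinite in $n$) sums $\sum_n\sum_{\sigma\in S_n}f_\sigma\,\sigma$ with $f_\sigma\in K[[x_1,\dots,x_n]]$. For a word $w=w(1)\cdots w(n)$ with distinct letters in the positive integers, its standardization $\mathrm{st}(w)\in S_n$ is the unique permutation with $\mathrm{st}(w)(i)\le\mathrm{st}(w)(j)\iff w(i)\le w(j)$. If such $w$ has letters $a_1<\dots<a_n$ and $f\in K[[x_1,\dots,x_n]]$, set $f(w)=f(x_{a_1},\dots,x_{a_n})$.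 For $\sigma\in S_s$, $\tau\in S_t$, the set $\sigma\star\tau$ consists of all $w\in S_{s+t}$ with $\mathrm{st}(w(1)\cdots w(s))=\sigma$ and $\mathrm{st}(w(s+1)\cdots w(s+t))=\tau$, and \[ (f\sigma)\star(g\tau)=\sum_{w\in\sigma\star\tau}f(w(1)\cdots w(s))\,g(w(s+1)\cdots w(s+t))\,w, \] extended bilinearly; this is associative. The infinite product $\cdots\star F(2)\star F(1)\star F(0)$ is the limit of the finite products $F(M)\star\cdots\star F(1)\star F(0)$ as $M\to\infty$, which exists coefficientwise since $F(m)-\varepsilon$ has all coefficients of total degree at least $m$. -}

module Defs where

open import Level using (Level; _⊔_)
open import Algebra.Bundles using (CommutativeRing)
open import Data.Nat as ℕ using (ℕ; zero; suc; _∸_; _<ᵇ_; _≡ᵇ_)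
open import Data.Nat.Properties using (m+[n∸m]≡n)
open import Data.Bool using (Bool; true; false; if_then_else_; _∧_; _∨_)
open import Data.Fin as Fin using (Fin; toℕ; inject≤; _↑ʳ_; cast; fromℕ<)
open import Data.Fin.Properties using (toℕ≤pred[n])
open import Data.List using (List; foldr; map; upTo; allFin)
open import Data.Vec.Functional using (_∷_)
open import Data.Product using (Σ; ∃; _×_)
open import Relation.Nullary using (¬_)
open import Relation.Binary.PropositionalEquality using (_≡_)

sumℕ : ∀ {n} → (Fin n → ℕ) → ℕ
sumℕ {n} f = foldr ℕ._+_ 0 (map f (allFin n))

countᵇ : ∀ {n} → (Fin n → Bool) → ℕ
countᵇ p = sumℕ (λ j → if p j then 1 else 0)

allᵇ anyᵇ : ∀ {n} → (Fin n → Bool) → Bool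
allᵇ {n} p = foldr _∧_ true  (map p (allFin n))
anyᵇ {n} p = foldr _∨_ false (map p (allFin n))

_==ᶠ_ : ∀ {n} → Fin n → Fin n → Bool
i ==ᶠ j = toℕ i ≡ᵇ toℕ j

_<ᶠ_ : ∀ {n} → Fin n → Fin n → Bool
i <ᶠ j = toℕ i <ᵇ toℕ j

-- Standardization of a word u(0)…u(s-1) with letters in Fin n.
-- st u i = #{ j : u j < u i }  (a value in Fin s; for words with
-- distinct letters this count is always < s, the fallback `i` below
-- is never used on such words).

clamp : ∀ {s} → Fin s → ℕ → Fin s
clamp {s} i k with k ℕ.<? s
... | Relation.Nullary.yes k<s = fromℕ< k<s
... | Relation.Nullary.no  _   = i

st : ∀ {s n} → (Fin s → Fin n) → Fin s → Fin s
st u i = clamp i (countᵇ (λ j → u j <ᶠ u i))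

isIdᵇ : ∀ {n} → (Fin n → Fin n) → Bool
isIdᵇ w = allᵇ (λ i → w i ==ᶠ i)

module Over {c ℓ : Level} (R : CommutativeRing c ℓ) where
  open CommutativeRing R

  record IsField : Set (c ⊔ ℓ) where
    field
      1≉0     : ¬ (1# ≈ 0#)
      inverse : ∀ x → ¬ (x ≈ 0#) → Σ Carrier (λ y → x * y ≈ 1#)

  natK : ℕ → Carrier
  natK zero    = 0#
  natK (suc n) = 1# + natK n

  CharZero : Set ℓ
  CharZero = ∀ n → ¬ (natK (suc n) ≈ 0#)

  Σᴷ : ∀ {n} → (Fin n → Carrier) → Carrier
  Σᴷ {n} f = foldr _+_ 0# (map f (allFin n))

  ΣᴷupTo : ℕ → (ℕ → Carrier) → Carrier
  ΣᴷupTo m f = foldr _+_ 0# (map f (upTo m))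

  -- Formal power series in n variables: a coefficient for every
  -- exponent vector (monomial x_1^{e 0} ⋯ x_n^{e (n-1)}).
  Ser : ℕ → Set c
  Ser n = (Fin n → ℕ) → Carrier

  _≈ˢ_ : ∀ {n} → Ser n → Ser n → Set ℓ
  f ≈ˢ g = ∀ E → f E ≈ g E

  eqExpᵇ : ∀ {n} → (Fin n → ℕ) → (Fin n → ℕ) → Bool
  eqExpᵇ E e = allᵇ (λ v → E v ≡ᵇ e v)

  mono : ∀ {n} → (Fin n → ℕ) → Ser n
  mono e E = if eqExpᵇ E e then 1# else 0#

  oneˢ : ∀ {n} → Ser n
  oneˢ = mono (λ _ → 0)

  _-ˢ_ : ∀ {n} → Ser n → Ser n → Ser n
  (f -ˢ g) E = f E - g E

  zeroˢ : ∀ {n} → Ser n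
  zeroˢ _ = 0#

  -- product of power series (Cauchy product, variable by variable)
  _·ˢ_ : ∀ {n} → Ser n → Ser n → Ser n
  _·ˢ_ {zero}  f g E = f E * g E
  _·ˢ_ {suc n} f g E =
    ΣᴷupTo (suc (E Fin.zero)) (λ a →
      _·ˢ_ {n} (λ e → f (a ∷ e)) (λ e → g ((E Fin.zero ∸ a) ∷ e)) (λ v → E (Fin.suc v)))

  ∏ˢ : ∀ {n} → (m : ℕ) → (ℕ → Ser n) → Ser n
  ∏ˢ zero    f = oneˢ
  ∏ˢ (suc m) f = ∏ˢ m f ·ˢ f m

  -- f(x_{a_1},…,x_{a_s}) viewed in K[[x_1..x_n]], where a_1<⋯<a_s are the
  -- letters of the word u (with distinct letters).  The variable x_k of f
  -- is sent to x_{a_k}, i.e. to x_{u j} where st u j = k.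
  substW : ∀ {s n} → (Fin s → Fin n) → Ser s → Ser n
  substW {s} u f E =
    if allᵇ (λ v → (E v ≡ᵇ 0) ∨ anyᵇ (λ j → u j ==ᶠ v))
    then f (λ k → sumℕ (λ j → if st u j ==ᶠ k then E (u j) else 0))
    else 0#

  -- Elements of ⊕_n K[[x_1..x_n]] S_n: a coefficient series for every
  -- n and every σ ∈ S_n.  Permutations are given as maps Fin n → Fin n
  -- (the word σ(1)⋯σ(n), 0-based); values at non-bijective maps are
  -- irrelevant (only bijective indices are ever inspected in the theorem).
  Alg : Set c
  Alg = (n : ℕ) → (Fin n → Fin n) → Ser n

  -- the product ⋆:  the coefficient of w ∈ S_n in A ⋆ B is
  -- Σ_{s+t=n} A_{st(w(1..s))}(w(1..s)) · B_{st(w(s+1..n))}(w(s+1..n)).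
  _⋆_ : Alg → Alg → Alg
  (A ⋆ B) n w =
    λ E → Σᴷ {suc n} (λ k →
      let s   = toℕ k
          s≤n = toℕ≤pred[n] k
          pre : Fin s → Fin n
          pre i = w (inject≤ i s≤n)
          suf : Fin (n ∸ s) → Fin n
          suf j = w (cast (m+[n∸m]≡n s≤n) (s ↑ʳ j))
      in (substW pre (A s (st pre)) ·ˢ substW suf (B (n ∸ s) (st suf))) E)

  F : ℕ → Alg
  F m n w = if isIdᵇ w then mono (λ _ → m) else zeroˢ

  Fprod : ℕ → Alg
  Fprod zero    = F 0
  Fprod (suc M) = F (suc M) ⋆ Fprod M

  -- Ingredients of Θ for σ = w : Fin n → Fin n (positions 0-based).
  -- P w i = x_{σ(1)} ⋯ x_{σ(i)}  (the product of the first i letters)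
  P : ∀ {n} → (Fin n → Fin n) → ℕ → Ser n
  P w i = mono (λ v → if anyᵇ (λ k → (toℕ k <ᵇ i) ∧ (w k ==ᶠ v)) then 1 else 0)

  -- j ∈ D(σ) (1 ≤ j ≤ n-1) iff σ(j) > σ(j+1); with 0-based positions,
  -- j ∈ D(σ) iff j < n and w(j-1) > w(j).
  inDᵇ : ∀ {n} → (Fin n → Fin n) → ℕ → Bool
  inDᵇ w j = anyᵇ (λ k → anyᵇ (λ k′ →
    (suc (toℕ k) ≡ᵇ j) ∧ ((toℕ k′ ≡ᵇ j) ∧ (w k′ <ᶠ w k))))

  ΘNum : ∀ {n} → (Fin n → Fin n) → Ser n
  ΘNum {n} w = ∏ˢ n (λ j → if inDᵇ w j then P w j else oneˢ)

  ΘDen : ∀ {n} → (Fin n → Fin n) → Ser n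
  ΘDen {n} w = ∏ˢ n (λ i → oneˢ -ˢ P w (suc i))

{-# OPTIONS --safe #-}
-- Write V p = E (σ p) for the weights of an exponent vector E read along σ. The coefficient of Θ at σ
-- and E is 1 exactly when V is a descent chain: V p ≥ V (p + 1) + 1 at the descents of σ and
-- V p ≥ V (p + 1) elsewhere (V n = 0); otherwise it is 0.
--
-- Denominator: multiplying by 1 − x_{σ(1)}⋯x_{σ(i+1)} subtracts the coefficient at E with its first
-- i + 1 weights lowered by one, which turns the (i + 1)-st inequality of the chain into an equality.
-- After all n factors the chain is tight everywhere, so each V p counts the descents after position p,
-- i.e. E is the exponent of the numerator ∏_{j ∈ D(σ)} x_{σ(1)}⋯x_{σ(j)}.
--
-- Product: by induction, F(M) ⋆ ⋯ ⋆ F(0) has coefficient 1 at σ and E exactly when V is a descent chain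
-- bounded by M. In F(M + 1) ⋆ X the only split of σ that contributes is the one after the maximal
-- initial block of weights M + 1; F forces that block to be increasing, and X makes the rest a chain
-- bounded by M. Once M ≥ Σ E the bound is vacuous.

module Submission where

open import Defs
open import Algebra.Bundles using (CommutativeRing)
open import Data.Nat using (ℕ; _≤_)
open import Data.Fin using (Fin)
open import Data.Product using (Σ; ∃; _×_; _,_)
open import Function.Definitions using (Injective)
open import Relation.Binary.PropositionalEquality using (_≡_)

module Combinatorics where

  open import Data.Bool using (Bool; true; false; if_then_else_; _∧_; _∨_; T; T?)
  open import Data.Bool.Properties using (T-∧; T-∨; ∧-zeroʳ; ∧-identityʳ)
  open import Data.Empty using (⊥-elim)
  open import Data.Fin as Fin using (toℕ; fromℕ<)
  open import Data.Fin.Properties as FinP using (any?; toℕ-injective; toℕ<n; toℕ-fromℕ<; fromℕ<-toℕ; pigeonhole; punchOut-injective)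
  open import Data.List using (foldr; map; upTo; allFin)
  open import Data.List.Properties using (map-tabulate; map-applyUpTo)
  open import Data.Nat using (zero; suc; _+_; _∸_; _<_; _<ᵇ_; _≤ᵇ_; _≡ᵇ_; z≤n; s≤s; s≤s⁻¹)
  open import Data.Nat.Properties
  open import Algebra.Properties.CommutativeSemigroup +-commutativeSemigroup using (xy∙z≈xz∙y)
  open import Data.Product using (proj₁; proj₂)
  open import Data.Sum using (_⊎_; inj₁; inj₂)
  open import Data.Unit using (tt)
  open import Data.Vec.Functional using (tail)
  open import Function using (_∘_; id; Equivalence)
  open import Relation.Binary using (tri<; tri≈; tri>)
  open import Relation.Binary.PropositionalEquality
  open import Relation.Nullary using (¬_; Dec; yes; no)

  T-ext : ∀ {a b} → (T a → T b) → (T b → T a) → a ≡ b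
  T-ext {false} {false} _ _ = refl
  T-ext {false} {true}  _ g = ⊥-elim (g tt)
  T-ext {true}  {false} f _ = ⊥-elim (f tt)
  T-ext {true}  {true}  _ _ = refl

  T⇒≡true : ∀ {b} → T b → b ≡ true
  T⇒≡true {true} _ = refl

  ≡true⇒T : ∀ {b} → b ≡ true → T b
  ≡true⇒T refl = tt

  ¬T⇒≡false : ∀ {b} → ¬ T b → b ≡ false
  ¬T⇒≡false {false} _ = refl
  ¬T⇒≡false {true}  h = ⊥-elim (h tt)

  T-∧⁺ : ∀ {a b} → T a → T b → T (a ∧ b)
  T-∧⁺ x y = Equivalence.from T-∧ (x , y)

  T-∧⁻ : ∀ {a b} → T (a ∧ b) → T a × T b
  T-∧⁻ = Equivalence.to T-∧

  guarded-∧-comm : ∀ {g a b} → (T g → a ≡ b) → a ∧ g ≡ g ∧ b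
  guarded-∧-comm {false} _   = ∧-zeroʳ _
  guarded-∧-comm {true}  a≡b = trans (∧-identityʳ _) (a≡b tt)

  [_]ℕ : Bool → ℕ
  [ b ]ℕ = if b then 1 else 0

  module _ {a} {A : Set a} (_∙_ : A → A → A) (ε : A) where

    foldr-allFin-suc : ∀ {n} (f : Fin (suc n) → A) →
      foldr _∙_ ε (map f (allFin (suc n))) ≡ f Fin.zero ∙ foldr _∙_ ε (map (f ∘ Fin.suc) (allFin n))
    foldr-allFin-suc f = cong (λ xs → f Fin.zero ∙ foldr _∙_ ε xs)
      (trans (map-tabulate Fin.suc f) (sym (map-tabulate id (f ∘ Fin.suc))))

    foldr-upTo-suc : ∀ m (f : ℕ → A) →
      foldr _∙_ ε (map f (upTo (suc m))) ≡ f 0 ∙ foldr _∙_ ε (map (f ∘ suc) (upTo m))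
    foldr-upTo-suc m f = cong (λ xs → f 0 ∙ foldr _∙_ ε xs)
      (trans (map-applyUpTo suc f m) (sym (map-applyUpTo id (f ∘ suc) m)))

  allᵇ-suc : ∀ {n} (p : Fin (suc n) → Bool) → allᵇ p ≡ p Fin.zero ∧ allᵇ (p ∘ Fin.suc)
  allᵇ-suc = foldr-allFin-suc _∧_ true

  anyᵇ-suc : ∀ {n} (p : Fin (suc n) → Bool) → anyᵇ p ≡ p Fin.zero ∨ anyᵇ (p ∘ Fin.suc)
  anyᵇ-suc = foldr-allFin-suc _∨_ false

  sumℕ-suc : ∀ {n} (f : Fin (suc n) → ℕ) → sumℕ f ≡ f Fin.zero + sumℕ (f ∘ Fin.suc)
  sumℕ-suc = foldr-allFin-suc _+_ 0

  allᵇ⁻ : ∀ {n} (p : Fin n → Bool) → T (allᵇ p) → ∀ i → T (p i)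
  allᵇ⁻ p h Fin.zero    rewrite allᵇ-suc p = proj₁ (T-∧⁻ h)
  allᵇ⁻ p h (Fin.suc i) rewrite allᵇ-suc p = allᵇ⁻ (p ∘ Fin.suc) (proj₂ (T-∧⁻ {p Fin.zero} h)) i

  allᵇ⁺ : ∀ {n} (p : Fin n → Bool) → (∀ i → T (p i)) → T (allᵇ p)
  allᵇ⁺ {zero}  p h = tt
  allᵇ⁺ {suc n} p h rewrite allᵇ-suc p = T-∧⁺ (h Fin.zero) (allᵇ⁺ (p ∘ Fin.suc) (h ∘ Fin.suc))

  anyᵇ⁻ : ∀ {n} (p : Fin n → Bool) → T (anyᵇ p) → ∃ λ i → T (p i)
  anyᵇ⁻ {suc n} p h rewrite anyᵇ-suc p with p Fin.zero in eq
  ... | true  = Fin.zero , ≡true⇒T eq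
  ... | false = let i , pi = anyᵇ⁻ (p ∘ Fin.suc) h in Fin.suc i , pi

  anyᵇ⁺ : ∀ {n} (p : Fin n → Bool) i → T (p i) → T (anyᵇ p)
  anyᵇ⁺ p Fin.zero    h rewrite anyᵇ-suc p | T⇒≡true h = tt
  anyᵇ⁺ p (Fin.suc i) h rewrite anyᵇ-suc p with p Fin.zero
  ... | true  = tt
  ... | false = anyᵇ⁺ (p ∘ Fin.suc) i h

  allᵇ-cong : ∀ {n} {p q : Fin n → Bool} → (∀ i → p i ≡ q i) → allᵇ p ≡ allᵇ q
  allᵇ-cong {p = p} {q} h = T-ext (λ t → allᵇ⁺ q (λ i → subst T (h i) (allᵇ⁻ p t i)))
                                  (λ t → allᵇ⁺ p (λ i → subst T (sym (h i)) (allᵇ⁻ q t i)))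

  sumℕ-cong : ∀ {n} {f g : Fin n → ℕ} → (∀ i → f i ≡ g i) → sumℕ f ≡ sumℕ g
  sumℕ-cong {zero}          h = refl
  sumℕ-cong {suc n} {f} {g} h rewrite sumℕ-suc f | sumℕ-suc g = cong₂ _+_ (h Fin.zero) (sumℕ-cong (h ∘ Fin.suc))

  sumℕ-zero : ∀ {n} (f : Fin n → ℕ) → (∀ i → f i ≡ 0) → sumℕ f ≡ 0
  sumℕ-zero {zero}  f h = refl
  sumℕ-zero {suc n} f h rewrite sumℕ-suc f | h Fin.zero = sumℕ-zero (f ∘ Fin.suc) (h ∘ Fin.suc)

  sumℕ-single : ∀ {n} (f : Fin n → ℕ) i₀ → (∀ i → i ≢ i₀ → f i ≡ 0) → sumℕ f ≡ f i₀
  sumℕ-single f Fin.zero h rewrite sumℕ-suc f =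
    trans (cong (f Fin.zero +_) (sumℕ-zero (f ∘ Fin.suc) (λ i → h (Fin.suc i) λ ()))) (+-identityʳ _)
  sumℕ-single f (Fin.suc i₀) h rewrite sumℕ-suc f | h Fin.zero (λ ()) =
    sumℕ-single (f ∘ Fin.suc) i₀ (λ i i≢i₀ → h (Fin.suc i) (i≢i₀ ∘ FinP.suc-injective))

  ≤sumℕ : ∀ {n} (f : Fin n → ℕ) i → f i ≤ sumℕ f
  ≤sumℕ f Fin.zero    rewrite sumℕ-suc f = m≤m+n _ _
  ≤sumℕ f (Fin.suc i) rewrite sumℕ-suc f = ≤-trans (≤sumℕ (f ∘ Fin.suc) i) (m≤n+m _ _)

  countᵇ-suc : ∀ {n} (p : Fin (suc n) → Bool) → countᵇ p ≡ [ p Fin.zero ]ℕ + countᵇ (p ∘ Fin.suc)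
  countᵇ-suc p = sumℕ-suc (λ j → [ p j ]ℕ)

  countᵇ-cong : ∀ {n} {p q : Fin n → Bool} → (∀ i → p i ≡ q i) → countᵇ p ≡ countᵇ q
  countᵇ-cong h = sumℕ-cong (λ i → cong [_]ℕ (h i))

  countᵇ-mono : ∀ {n} (p q : Fin n → Bool) → (∀ i → T (p i) → T (q i)) → countᵇ p ≤ countᵇ q
  countᵇ-mono {zero}  p q h = z≤n
  countᵇ-mono {suc n} p q h rewrite countᵇ-suc p | countᵇ-suc q with p Fin.zero in p0 | q Fin.zero in q0
  ... | true  | true  = s≤s (countᵇ-mono _ _ (h ∘ Fin.suc))
  ... | true  | false = ⊥-elim (subst T q0 (h Fin.zero (≡true⇒T p0)))
  ... | false | true  = m≤n⇒m≤1+n (countᵇ-mono _ _ (h ∘ Fin.suc))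
  ... | false | false = countᵇ-mono _ _ (h ∘ Fin.suc)

  countᵇ-strict : ∀ {n} (p q : Fin n → Bool) → (∀ i → T (p i) → T (q i)) →
    ∀ j → T (q j) → ¬ T (p j) → countᵇ p < countᵇ q
  countᵇ-strict p q h Fin.zero qj ¬pj rewrite countᵇ-suc p | countᵇ-suc q | ¬T⇒≡false ¬pj | T⇒≡true qj =
    s≤s (countᵇ-mono _ _ (h ∘ Fin.suc))
  countᵇ-strict p q h (Fin.suc j) qj ¬pj rewrite countᵇ-suc p | countᵇ-suc q with p Fin.zero in p0 | q Fin.zero in q0
  ... | true  | true  = s≤s (countᵇ-strict _ _ (h ∘ Fin.suc) j qj ¬pj)
  ... | true  | false = ⊥-elim (subst T q0 (h Fin.zero (≡true⇒T p0)))
  ... | false | true  = m≤n⇒m≤1+n (countᵇ-strict _ _ (h ∘ Fin.suc) j qj ¬pj)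
  ... | false | false = countᵇ-strict _ _ (h ∘ Fin.suc) j qj ¬pj

  countᵇ≤ : ∀ {n} (p : Fin n → Bool) → countᵇ p ≤ n
  countᵇ≤ {zero}  p = z≤n
  countᵇ≤ {suc n} p rewrite countᵇ-suc p with p Fin.zero
  ... | true  = s≤s (countᵇ≤ (p ∘ Fin.suc))
  ... | false = m≤n⇒m≤1+n (countᵇ≤ (p ∘ Fin.suc))

  countᵇ< : ∀ {n} (p : Fin n → Bool) j → ¬ T (p j) → countᵇ p < n
  countᵇ< p Fin.zero ¬pj rewrite countᵇ-suc p | ¬T⇒≡false ¬pj = s≤s (countᵇ≤ (p ∘ Fin.suc))
  countᵇ< p (Fin.suc j) ¬pj rewrite countᵇ-suc p with p Fin.zero
  ... | true  = s≤s (countᵇ< (p ∘ Fin.suc) j ¬pj)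
  ... | false = m≤n⇒m≤1+n (countᵇ< (p ∘ Fin.suc) j ¬pj)

  countᵇ-<ᶠ : ∀ {n} (i : Fin n) → countᵇ (_<ᶠ i) ≡ toℕ i
  countᵇ-<ᶠ {suc n} Fin.zero    rewrite countᵇ-suc {n} (_<ᶠ Fin.zero) = sumℕ-zero {n} _ (λ _ → refl)
  countᵇ-<ᶠ {suc n} (Fin.suc i) rewrite countᵇ-suc {n} (_<ᶠ Fin.suc i) = cong suc (countᵇ-<ᶠ i)

  rank : ∀ {s n} → (Fin s → Fin n) → Fin s → ℕ
  rank u i = countᵇ (λ j → u j <ᶠ u i)

  <ᵇ-irrefl : ∀ m → ¬ T (m <ᵇ m)
  <ᵇ-irrefl m h = n≮n m (<ᵇ⇒< m m h)

  <ᶠ-irrefl : ∀ {n} (i : Fin n) → ¬ T (i <ᶠ i)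
  <ᶠ-irrefl i = <ᵇ-irrefl (toℕ i)

  rank< : ∀ {s n} (u : Fin s → Fin n) i → rank u i < s
  rank< u i = countᵇ< (λ j → u j <ᶠ u i) i (<ᶠ-irrefl (u i))

  toℕ-st : ∀ {s n} (u : Fin s → Fin n) i → toℕ (st u i) ≡ rank u i
  toℕ-st {s} u i with rank u i <? s
  ... | yes r<s = toℕ-fromℕ< r<s
  ... | no  r≮s = ⊥-elim (r≮s (rank< u i))

  st-<-mono : ∀ {s n} (u : Fin s → Fin n) a b → toℕ (u a) < toℕ (u b) → toℕ (st u a) < toℕ (st u b)
  st-<-mono u a b ua<ub rewrite toℕ-st u a | toℕ-st u b =
    countᵇ-strict (λ j → u j <ᶠ u a) (λ j → u j <ᶠ u b)
      (λ j uj<ua → <⇒<ᵇ (<-trans (<ᵇ⇒< _ _ uj<ua) ua<ub)) a (<⇒<ᵇ ua<ub) (<ᶠ-irrefl (u a))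

  st-<-reflect : ∀ {s n} (u : Fin s → Fin n) → Injective _≡_ _≡_ u →
    ∀ a b → toℕ (st u a) < toℕ (st u b) → toℕ (u a) < toℕ (u b)
  st-<-reflect u inj a b lt with <-cmp (toℕ (u a)) (toℕ (u b))
  ... | tri< ua<ub _ _ = ua<ub
  ... | tri≈ _ ua≡ub _ rewrite inj (toℕ-injective ua≡ub) = ⊥-elim (n≮n _ lt)
  ... | tri> _ _ ub<ua = ⊥-elim (<-asym lt (st-<-mono u b a ub<ua))

  st-injective : ∀ {s n} (u : Fin s → Fin n) → Injective _≡_ _≡_ u → Injective _≡_ _≡_ (st u)
  st-injective u inj {a} {b} eq with <-cmp (toℕ (u a)) (toℕ (u b))
  ... | tri< ua<ub _ _ = ⊥-elim (<-irrefl (cong toℕ eq) (st-<-mono u a b ua<ub))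
  ... | tri≈ _ ua≡ub _ = inj (toℕ-injective ua≡ub)
  ... | tri> _ _ ub<ua = ⊥-elim (<-irrefl (cong toℕ (sym eq)) (st-<-mono u b a ub<ua))

  st-<ᶠ : ∀ {s n} (u : Fin s → Fin n) → Injective _≡_ _≡_ u → ∀ a b → (st u a <ᶠ st u b) ≡ (u a <ᶠ u b)
  st-<ᶠ u inj a b = T-ext (λ h → <⇒<ᵇ (st-<-reflect u inj a b (<ᵇ⇒< _ _ h)))
                          (λ h → <⇒<ᵇ (st-<-mono u a b (<ᵇ⇒< _ _ h)))

  Increasing : ∀ {s n} → (Fin s → Fin n) → Set
  Increasing u = ∀ a b → toℕ a < toℕ b → toℕ (u a) < toℕ (u b)

  st-increasing : ∀ {s n} (u : Fin s → Fin n) → Increasing u → ∀ i → st u i ≡ i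
  st-increasing u inc i = toℕ-injective (trans (toℕ-st u i)
    (trans (countᵇ-cong (λ j → T-ext (below j) (λ j<i → <⇒<ᵇ (inc j i (<ᵇ⇒< _ _ j<i))))) (countᵇ-<ᶠ i)))
    where
    below : ∀ j → T (u j <ᶠ u i) → T (j <ᶠ i)
    below j uj<ui with <-cmp (toℕ j) (toℕ i)
    ... | tri< j<i _ _ = <⇒<ᵇ j<i
    ... | tri≈ _ j≡i _ rewrite toℕ-injective j≡i = ⊥-elim (<ᶠ-irrefl (u i) uj<ui)
    ... | tri> _ _ i<j = ⊥-elim (<-asym (<ᵇ⇒< _ _ uj<ui) (inc i j i<j))

  injective⇒surjective : ∀ {n} (σ : Fin n → Fin n) → Injective _≡_ _≡_ σ → ∀ v → ∃ λ i → σ i ≡ v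
  injective⇒surjective {suc m} σ inj v with any? (λ i → σ i FinP.≟ v)
  ... | yes hit = hit
  ... | no  miss = let i , j , i<j , fi≡fj = pigeonhole (n<1+n m) (λ i → Fin.punchOut (avoid i))
                   in ⊥-elim (<-irrefl (cong toℕ (inj (punchOut-injective (avoid i) (avoid j) fi≡fj))) i<j)
    where
    avoid : ∀ i → v ≢ σ i
    avoid i v≡σi = miss (i , sym v≡σi)

  -- Words read as sequences ℕ → ℕ, padded with zeros

  at : ∀ {s} → (Fin s → ℕ) → ℕ → ℕ
  at {s} f p with p <? s
  ... | yes p<s = f (fromℕ< p<s)
  ... | no  _   = 0

  at-< : ∀ {s} (f : Fin s → ℕ) p (p<s : p < s) → at f p ≡ f (fromℕ< p<s)
  at-< {s} f p p<s with p <? s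
  ... | yes _    = refl
  ... | no  p≮s  = ⊥-elim (p≮s p<s)

  at-≥ : ∀ {s} (f : Fin s → ℕ) p → s ≤ p → at f p ≡ 0
  at-≥ {s} f p s≤p with p <? s
  ... | yes p<s = ⊥-elim (<⇒≱ p<s s≤p)
  ... | no  _   = refl

  at-toℕ : ∀ {s} (f : Fin s → ℕ) i → at f (toℕ i) ≡ f i
  at-toℕ f i = trans (at-< f (toℕ i) (toℕ<n i)) (cong f (fromℕ<-toℕ i (toℕ<n i)))

  at-map : ∀ {s} (f g : Fin s → ℕ) (F : ℕ → ℕ → ℕ) → (∀ q → g q ≡ F (toℕ q) (f q)) → (∀ p → F p 0 ≡ 0) →
    ∀ p → at g p ≡ F p (at f p)
  at-map {s} f g F g≡Ff F0 p with p <? s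
  ... | yes p<s = trans (g≡Ff (fromℕ< p<s)) (cong (λ x → F x (f (fromℕ< p<s))) (toℕ-fromℕ< p<s))
  ... | no  _   = sym (F0 p)

  at-prefix : ∀ {s n} (f : Fin n → ℕ) (u : Fin s → Fin n) → (∀ i → toℕ (u i) ≡ toℕ i) →
    ∀ p → p < s → at (f ∘ u) p ≡ at f p
  at-prefix {s} {n} f u u≗id p p<s =
    trans (at-< (f ∘ u) p p<s)
          (trans (cong f (toℕ-injective (trans (u≗id _) (trans (toℕ-fromℕ< p<s) (sym (toℕ-fromℕ< p<n))))))
                 (sym (at-< f p p<n)))
    where
    p<n : p < n
    p<n = subst (_< n) (trans (u≗id _) (toℕ-fromℕ< p<s)) (toℕ<n (u (fromℕ< p<s)))

  at-suffix : ∀ {t n} s (f : Fin n → ℕ) (u : Fin t → Fin n) → (∀ j → toℕ (u j) ≡ s + toℕ j) → s + t ≡ n →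
    ∀ p → at (f ∘ u) p ≡ at f (s + p)
  at-suffix {t} {n} s f u u≗s+ s+t≡n p with p <? t
  ... | yes p<t = trans (cong f (toℕ-injective (trans (u≗s+ _) (trans (cong (s +_) (toℕ-fromℕ< p<t)) (sym (toℕ-fromℕ< s+p<n))))))
                        (sym (at-< f (s + p) s+p<n))
    where
    s+p<n : s + p < n
    s+p<n = subst (s + p <_) s+t≡n (+-monoʳ-< s p<t)
  ... | no p≮t = sym (at-≥ f (s + p) (subst (_≤ s + p) s+t≡n (+-monoʳ-≤ s (≮⇒≥ p≮t))))

  all<ᵇ : ℕ → (ℕ → Bool) → Bool
  all<ᵇ zero    P = true
  all<ᵇ (suc k) P = all<ᵇ k P ∧ P k

  all<ᵇ⁻ : ∀ k P → T (all<ᵇ k P) → ∀ p → p < k → T (P p)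
  all<ᵇ⁻ (suc k) P h p p<1+k with m≤n⇒m<n∨m≡n (s≤s⁻¹ p<1+k)
  ... | inj₁ p<k  = all<ᵇ⁻ k P (proj₁ (T-∧⁻ h)) p p<k
  ... | inj₂ refl = proj₂ (T-∧⁻ {all<ᵇ k P} h)

  all<ᵇ⁺ : ∀ k P → (∀ p → p < k → T (P p)) → T (all<ᵇ k P)
  all<ᵇ⁺ zero    P h = tt
  all<ᵇ⁺ (suc k) P h = T-∧⁺ (all<ᵇ⁺ k P (λ p p<k → h p (m≤n⇒m≤1+n p<k))) (h k ≤-refl)

  all<ᵇ-cong : ∀ k {P Q} → (∀ p → p < k → P p ≡ Q p) → all<ᵇ k P ≡ all<ᵇ k Q
  all<ᵇ-cong zero    h = refl
  all<ᵇ-cong (suc k) h = cong₂ _∧_ (all<ᵇ-cong k (λ p p<k → h p (m≤n⇒m≤1+n p<k))) (h k ≤-refl)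

  stepwise-antitone : ∀ (V : ℕ → ℕ) i → (∀ p → p < i → V (suc p) ≤ V p) → ∀ p → p ≤ i → V i ≤ V p
  stepwise-antitone V zero    steps .zero z≤n = ≤-refl
  stepwise-antitone V (suc i) steps p p≤1+i with m≤n⇒m<n∨m≡n p≤1+i
  ... | inj₂ refl = ≤-refl
  ... | inj₁ p<1+i = ≤-trans (steps i ≤-refl)
                       (stepwise-antitone V i (λ q q<i → steps q (m≤n⇒m≤1+n q<i)) p (s≤s⁻¹ p<1+i))

  Ascending : ℕ → (ℕ → ℕ) → Set
  Ascending n L = ∀ p → suc p < n → L p < L (suc p)

  stepwise-increasing : ∀ (L : ℕ → ℕ) s → Ascending s L → ∀ a b → a < b → b < s → L a < L b
  stepwise-increasing L s steps a (suc b) a<1+b 1+b<s with m≤n⇒m<n∨m≡n (s≤s⁻¹ a<1+b)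
  ... | inj₂ refl = steps a 1+b<s
  ... | inj₁ a<b  = <-trans (stepwise-increasing L s steps a b a<b (<-trans (n<1+n b) 1+b<s)) (steps b 1+b<s)

  descent : ℕ → (ℕ → ℕ) → ℕ → ℕ
  descent len L p = [ (suc p <ᵇ len) ∧ (L (suc p) <ᵇ L p) ]ℕ

  descent≤1 : ∀ len L p → descent len L p ≤ 1
  descent≤1 len L p with (suc p <ᵇ len) ∧ (L (suc p) <ᵇ L p)
  ... | true  = ≤-refl
  ... | false = z≤n

  descent-ascent : ∀ len (L : ℕ → ℕ) p → (suc p < len → L p < L (suc p)) → descent len L p ≡ 0
  descent-ascent len L p asc with suc p <ᵇ len in inside
  ... | false = refl
  ... | true  = cong [_]ℕ (¬T⇒≡false (λ h → <-asym (<ᵇ⇒< _ _ h) (asc (<ᵇ⇒< _ _ (≡true⇒T inside)))))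

  descent-descent : ∀ len (L : ℕ → ℕ) p → suc p < len → L (suc p) < L p → descent len L p ≡ 1
  descent-descent len L p 1+p<len Lp+1<Lp rewrite T⇒≡true (<⇒<ᵇ 1+p<len) | T⇒≡true (<⇒<ᵇ Lp+1<Lp) = refl

  descent-cong : ∀ len {L L′ : ℕ → ℕ} → (∀ p → suc p < len → (L (suc p) <ᵇ L p) ≡ (L′ (suc p) <ᵇ L′ p)) →
    ∀ p → descent len L p ≡ descent len L′ p
  descent-cong len L≈L′ p with suc p <ᵇ len in inside
  ... | true  = cong [_]ℕ (L≈L′ p (<ᵇ⇒< _ _ (≡true⇒T inside)))
  ... | false = refl

  descent-shift : ∀ n s (L : ℕ → ℕ) q → s ≤ n → descent (n ∸ s) (λ p → L (s + p)) q ≡ descent n L (s + q)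
  descent-shift n s L q s≤n = cong [_]ℕ (cong₂ _∧_ inside (cong (λ x → L x <ᵇ L (s + q)) (+-suc s q)))
    where
    inside : (suc q <ᵇ n ∸ s) ≡ (suc (s + q) <ᵇ n)
    inside = T-ext
      (λ h → <⇒<ᵇ (subst (_< n) (+-suc s q) (subst (s + suc q <_) (m+[n∸m]≡n s≤n) (+-monoʳ-< s (<ᵇ⇒< _ _ h)))))
      (λ h → <⇒<ᵇ (+-cancelˡ-< s _ _ (subst₂ _<_ (sym (+-suc s q)) (sym (m+[n∸m]≡n s≤n)) (<ᵇ⇒< _ _ h))))

  module _ (n : ℕ) (δ : ℕ → ℕ) where

    Chain : (ℕ → ℕ) → Set
    Chain V = ∀ p → p < n → V (suc p) + δ p ≤ V p

    TightBelow : ℕ → (ℕ → ℕ) → Set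
    TightBelow i V = ∀ p → p < n → (p < i → V (suc p) + δ p ≡ V p) × (i ≤ p → V (suc p) + δ p ≤ V p)

  Bounded : ℕ → (ℕ → ℕ) → ℕ → Set
  Bounded n V M = ∀ p → p < n → V p ≤ M

  gapᵇ : (ℕ → ℕ) → ℕ → (ℕ → ℕ) → ℕ → Bool
  gapᵇ δ i V p = if p <ᵇ i then V (suc p) + δ p ≡ᵇ V p else V (suc p) + δ p ≤ᵇ V p

  tightᵇ : ℕ → (ℕ → ℕ) → ℕ → (ℕ → ℕ) → Bool
  tightᵇ n δ i V = all<ᵇ n (gapᵇ δ i V)

  chainᵇ : ℕ → (ℕ → ℕ) → (ℕ → ℕ) → Bool
  chainᵇ n δ V = tightᵇ n δ 0 V

  boundedᵇ : ℕ → (ℕ → ℕ) → ℕ → Bool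
  boundedᵇ n V M = all<ᵇ n (λ p → V p ≤ᵇ M)

  tightᵇ⁻ : ∀ n δ i V → T (tightᵇ n δ i V) → TightBelow n δ i V
  tightᵇ⁻ n δ i V h p p<n with p <ᵇ i in p<ᵇi | all<ᵇ⁻ n (gapᵇ δ i V) h p p<n
  ... | true  | gap = (λ _ → ≡ᵇ⇒≡ _ _ gap) , (λ i≤p → ⊥-elim (<⇒≱ (<ᵇ⇒< p i (≡true⇒T p<ᵇi)) i≤p))
  ... | false | gap = (λ p<i → ⊥-elim (subst T p<ᵇi (<⇒<ᵇ p<i))) , (λ _ → ≤ᵇ⇒≤ _ _ gap)

  tightᵇ⁺ : ∀ n δ i V → TightBelow n δ i V → T (tightᵇ n δ i V)
  tightᵇ⁺ n δ i V h = all<ᵇ⁺ n (gapᵇ δ i V) gap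
    where
    gap : ∀ p → p < n → T (gapᵇ δ i V p)
    gap p p<n with p <ᵇ i in p<ᵇi
    ... | true  = ≡⇒≡ᵇ _ _ (proj₁ (h p p<n) (<ᵇ⇒< p i (≡true⇒T p<ᵇi)))
    ... | false = ≤⇒≤ᵇ (proj₂ (h p p<n) (≮⇒≥ (λ p<i → subst T p<ᵇi (<⇒<ᵇ p<i))))

  chainᵇ⁻ : ∀ n δ V → T (chainᵇ n δ V) → Chain n δ V
  chainᵇ⁻ n δ V h p p<n = proj₂ (tightᵇ⁻ n δ 0 V h p p<n) z≤n

  chainᵇ⁺ : ∀ n δ V → Chain n δ V → T (chainᵇ n δ V)
  chainᵇ⁺ n δ V h = tightᵇ⁺ n δ 0 V (λ p p<n → (λ ()) , (λ _ → h p p<n))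

  boundedᵇ⁻ : ∀ n V M → T (boundedᵇ n V M) → Bounded n V M
  boundedᵇ⁻ n V M h p p<n = ≤ᵇ⇒≤ _ _ (all<ᵇ⁻ n _ h p p<n)

  boundedᵇ⁺ : ∀ n V M → Bounded n V M → T (boundedᵇ n V M)
  boundedᵇ⁺ n V M h = all<ᵇ⁺ n _ (λ p p<n → ≤⇒≤ᵇ (h p p<n))

  tightᵇ-cong : ∀ n {δ δ′ : ℕ → ℕ} i {V V′ : ℕ → ℕ} → (∀ p → p < n → δ p ≡ δ′ p) → (∀ p → V p ≡ V′ p) →
    tightᵇ n δ i V ≡ tightᵇ n δ′ i V′
  tightᵇ-cong n {δ} {δ′} i {V} {V′} δ≗δ′ V≗V′ = all<ᵇ-cong n (λ p p<n → gap p (δ≗δ′ p p<n))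
    where
    gap : ∀ p → δ p ≡ δ′ p → gapᵇ δ i V p ≡ gapᵇ δ′ i V′ p
    gap p δp≡δ′p rewrite δp≡δ′p | V≗V′ p | V≗V′ (suc p) = refl

  boundedᵇ-cong : ∀ n {V V′ : ℕ → ℕ} M → (∀ p → p < n → V p ≡ V′ p) → boundedᵇ n V M ≡ boundedᵇ n V′ M
  boundedᵇ-cong n M V≗V′ = all<ᵇ-cong n (λ p p<n → cong (_≤ᵇ M) (V≗V′ p p<n))

  module LowerPrefix (n : ℕ) (δ : ℕ → ℕ) (i : ℕ) (i<n : i < n) (V V′ : ℕ → ℕ)
                     (lowered : ∀ p → p ≤ i → V′ p ≡ V p ∸ 1) (kept : ∀ p → i < p → V′ p ≡ V p) where

    Positive : Set
    Positive = ∀ p → p ≤ i → 1 ≤ V p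

    tightBelow-suc⁻ : TightBelow n δ (suc i) V → TightBelow n δ i V
    tightBelow-suc⁻ h p p<n = (λ p<i → proj₁ (h p p<n) (m≤n⇒m≤1+n p<i)) , slack
      where
      slack : i ≤ p → V (suc p) + δ p ≤ V p
      slack i≤p with m≤n⇒m<n∨m≡n i≤p
      ... | inj₁ i<p  = proj₂ (h p p<n) i<p
      ... | inj₂ refl = ≤-reflexive (proj₁ (h i p<n) ≤-refl)

    tightBelow-suc⁺ : TightBelow n δ i V → V (suc i) + δ i ≡ V i → TightBelow n δ (suc i) V
    tightBelow-suc⁺ h tight-at-i p p<n = tight , (λ i<p → proj₂ (h p p<n) (<⇒≤ i<p))
      where
      tight : p < suc i → V (suc p) + δ p ≡ V p
      tight p<1+i with m≤n⇒m<n∨m≡n (s≤s⁻¹ p<1+i)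
      ... | inj₁ p<i  = proj₁ (h p p<n) p<i
      ... | inj₂ refl = tight-at-i

    tightBelow-suc⇒¬lowered : TightBelow n δ (suc i) V → Positive → ¬ TightBelow n δ i V′
    tightBelow-suc⇒¬lowered h positive h′ = <-irrefl refl (begin-strict
      V i               ≡⟨ sym (proj₁ (h i i<n) ≤-refl) ⟩
      V (suc i) + δ i   ≡⟨ cong (_+ δ i) (sym (kept (suc i) ≤-refl)) ⟩
      V′ (suc i) + δ i  ≤⟨ proj₂ (h′ i i<n) ≤-refl ⟩
      V′ i              ≡⟨ lowered i ≤-refl ⟩
      V i ∸ 1           <⟨ ∸-monoʳ-< {o = 0} (s≤s z≤n) (positive i ≤-refl) ⟩
      V i               ∎)
      where open ≤-Reasoning

    tightBelow⇒lowered : TightBelow n δ i V → V (suc i) + δ i ≢ V i → Positive × TightBelow n δ i V′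
    tightBelow⇒lowered h slack-at-i = positive , h′
      where
      strict : V (suc i) + δ i < V i
      strict = ≤∧≢⇒< (proj₂ (h i i<n) ≤-refl) slack-at-i
      steps : ∀ q → q < i → V (suc q) ≤ V q
      steps q q<i = ≤-trans (m≤m+n _ _) (≤-reflexive (proj₁ (h q (<-trans q<i i<n)) q<i))
      positive : Positive
      positive p p≤i = ≤-trans (≤-trans (s≤s z≤n) strict) (stepwise-antitone V i steps p p≤i)
      h′ : TightBelow n δ i V′
      h′ p p<n = tight , slack
        where
        tight : p < i → V′ (suc p) + δ p ≡ V′ p
        tight p<i = begin
          V′ (suc p) + δ p       ≡⟨ cong (_+ δ p) (lowered (suc p) p<i) ⟩
          (V (suc p) ∸ 1) + δ p  ≡⟨ sym (+-∸-comm (δ p) (positive (suc p) p<i)) ⟩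
          (V (suc p) + δ p) ∸ 1  ≡⟨ cong (_∸ 1) (proj₁ (h p p<n) p<i) ⟩
          V p ∸ 1                ≡⟨ sym (lowered p (<⇒≤ p<i)) ⟩
          V′ p                   ∎
          where open ≡-Reasoning
        slack : i ≤ p → V′ (suc p) + δ p ≤ V′ p
        slack i≤p with m≤n⇒m<n∨m≡n i≤p
        ... | inj₂ refl rewrite kept (suc i) ≤-refl | lowered i ≤-refl =
          m+n≤o⇒m≤o∸n (V (suc i) + δ i) (≤-trans (≤-reflexive (+-comm _ 1)) strict)
        ... | inj₁ i<p rewrite kept (suc p) (m<n⇒m<1+n i<p) | kept p i<p = proj₂ (h p p<n) i≤p

    lowered⇒tightBelow : Positive → TightBelow n δ i V′ → TightBelow n δ i V
    lowered⇒tightBelow positive h′ p p<n = tight , slack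
      where
      tight : p < i → V (suc p) + δ p ≡ V p
      tight p<i = ∸-cancelʳ-≡ {o = 1} (≤-trans (positive (suc p) p<i) (m≤m+n _ _)) (positive p (<⇒≤ p<i)) (begin
        (V (suc p) + δ p) ∸ 1  ≡⟨ +-∸-comm (δ p) (positive (suc p) p<i) ⟩
        (V (suc p) ∸ 1) + δ p  ≡⟨ cong (_+ δ p) (sym (lowered (suc p) p<i)) ⟩
        V′ (suc p) + δ p       ≡⟨ proj₁ (h′ p p<n) p<i ⟩
        V′ p                   ≡⟨ lowered p (<⇒≤ p<i) ⟩
        V p ∸ 1                ∎)
        where open ≡-Reasoning
      slack : i ≤ p → V (suc p) + δ p ≤ V p
      slack i≤p with m≤n⇒m<n∨m≡n i≤p
      ... | inj₂ refl = begin
        V (suc i) + δ i   ≡⟨ cong (_+ δ i) (sym (kept (suc i) ≤-refl)) ⟩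
        V′ (suc i) + δ i  ≤⟨ proj₂ (h′ i p<n) ≤-refl ⟩
        V′ i              ≡⟨ lowered i ≤-refl ⟩
        V i ∸ 1           ≤⟨ m∸n≤m (V i) 1 ⟩
        V i               ∎
        where open ≤-Reasoning
      ... | inj₁ i<p rewrite sym (kept (suc p) (m<n⇒m<1+n i<p)) | sym (kept p i<p) = proj₂ (h′ p p<n) i≤p

  backward-unique : ∀ n (δ V G : ℕ → ℕ) → (∀ p → p < n → V (suc p) + δ p ≡ V p) → (∀ p → p < n → G (suc p) + δ p ≡ G p) →
    V n ≡ G n → ∀ p → p ≤ n → V p ≡ G p
  backward-unique zero    δ V G _ _ end .zero z≤n = end
  backward-unique (suc m) δ V G V-step G-step end p p≤1+m with m≤n⇒m<n∨m≡n p≤1+m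
  ... | inj₂ refl  = end
  ... | inj₁ p<1+m = backward-unique m δ V G (λ q q<m → V-step q (m≤n⇒m≤1+n q<m)) (λ q q<m → G-step q (m≤n⇒m≤1+n q<m))
                       Vm≡Gm p (s≤s⁻¹ p<1+m)
    where
    Vm≡Gm : V m ≡ G m
    Vm≡Gm = trans (sym (V-step m ≤-refl)) (trans (cong (_+ δ m) end) (G-step m ≤-refl))

  descentsAbove : ℕ → (ℕ → Bool) → ℕ → ℕ
  descentsAbove zero    D p = 0
  descentsAbove (suc j) D p = descentsAbove j D p + (if D j then [ p <ᵇ j ]ℕ else 0)

  descentsAbove-≥ : ∀ j D p → j ≤ suc p → descentsAbove j D p ≡ 0
  descentsAbove-≥ zero    D p _ = refl
  descentsAbove-≥ (suc j) D p j<2+p rewrite descentsAbove-≥ j D p (m≤n⇒m≤1+n (s≤s⁻¹ j<2+p))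
                                          | ¬T⇒≡false (λ p<j → <⇒≱ (<ᵇ⇒< p j p<j) (s≤s⁻¹ j<2+p)) with D j
  ... | true  = refl
  ... | false = refl

  <ᵇ-≢suc : ∀ {p j} → j ≢ suc p → (p <ᵇ j) ≡ (suc p <ᵇ j)
  <ᵇ-≢suc {p} {j} j≢1+p =
    T-ext (λ p<j → <⇒<ᵇ (≤∧≢⇒< (<ᵇ⇒< p j p<j) (j≢1+p ∘ sym))) (λ 1+p<j → <⇒<ᵇ (<-trans (n<1+n p) (<ᵇ⇒< (suc p) j 1+p<j)))

  descentsAbove-step : ∀ j D p → descentsAbove j D p ≡ descentsAbove j D (suc p) + [ D (suc p) ∧ (suc p <ᵇ j) ]ℕ
  descentsAbove-step zero    D p = sym (cong [_]ℕ (∧-zeroʳ (D (suc p))))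
  descentsAbove-step (suc j) D p rewrite descentsAbove-step j D p with j ≟ suc p
  ... | no  j≢1+p rewrite <ᵇ-≢suc j≢1+p = xy∙z≈xz∙y (descentsAbove j D (suc p)) _ _
  ... | yes refl rewrite T⇒≡true (<⇒<ᵇ (n<1+n p)) | ¬T⇒≡false (<ᵇ-irrefl (suc p)) with D (suc p)
  ...   | true  = refl
  ...   | false = refl

  ascending-gap : ∀ n (L : ℕ → ℕ) → Ascending n L → ∀ p k → p + k < n → L p + k ≤ L (p + k)
  ascending-gap n L asc p zero    _         = ≤-reflexive (trans (+-identityʳ _) (cong L (sym (+-identityʳ p))))
  ascending-gap n L asc p (suc k) p+1+k<n = begin
    L p + suc k      ≡⟨ +-suc (L p) k ⟩
    suc (L p + k)    ≤⟨ s≤s (ascending-gap n L asc p k (<-trans (+-monoʳ-< p (n<1+n k)) p+1+k<n)) ⟩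
    suc (L (p + k))  ≤⟨ asc (p + k) (subst (_< n) (+-suc p k) p+1+k<n) ⟩
    L (suc (p + k))  ≡⟨ cong L (sym (+-suc p k)) ⟩
    L (p + suc k)    ∎
    where open ≤-Reasoning

  ascending-bounded⇒id : ∀ n (L : ℕ → ℕ) → Ascending n L → (∀ p → p < n → L p < n) → ∀ p → p < n → L p ≡ p
  ascending-bounded⇒id n L asc bounded p p<n = ≤-antisym upper lower
    where
    k = n ∸ suc p
    1+p+k≡n : suc (p + k) ≡ n
    1+p+k≡n = m+[n∸m]≡n p<n
    p+k<n : p + k < n
    p+k<n = subst (p + k <_) 1+p+k≡n (n<1+n (p + k))
    lower : p ≤ L p
    lower = ≤-trans (m≤n+m p (L 0)) (ascending-gap n L asc 0 p p<n)
    upper : L p ≤ p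
    upper = +-cancelʳ-≤ k (L p) p (s≤s⁻¹ (subst (L p + k <_) (sym 1+p+k≡n)
              (≤-<-trans (ascending-gap n L asc p k p+k<n) (bounded (p + k) p+k<n))))

  firstᵇ : ℕ → (ℕ → Bool) → ℕ
  firstᵇ zero    P = 0
  firstᵇ (suc k) P = if P 0 then 0 else suc (firstᵇ k (P ∘ suc))

  firstᵇ≤ : ∀ k P → firstᵇ k P ≤ k
  firstᵇ≤ zero    P = z≤n
  firstᵇ≤ (suc k) P with P 0
  ... | true  = z≤n
  ... | false = s≤s (firstᵇ≤ k (P ∘ suc))

  firstᵇ-minimal : ∀ k P q → q < firstᵇ k P → ¬ T (P q)
  firstᵇ-minimal (suc k) P q q<first with P 0 in P0
  firstᵇ-minimal (suc k) P zero    q<first       | false = subst (λ b → ¬ T b) (sym P0) (λ ())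
  firstᵇ-minimal (suc k) P (suc q) (s≤s q<first) | false = firstᵇ-minimal k (P ∘ suc) q q<first

  firstᵇ-found : ∀ k P → firstᵇ k P < k → T (P (firstᵇ k P))
  firstᵇ-found (suc k) P first<k with P 0 in P0
  ... | true  = ≡true⇒T P0
  ... | false = firstᵇ-found k (P ∘ suc) (s≤s⁻¹ first<k)

  module TopBlock (n M : ℕ) (L V : ℕ → ℕ)
                  (L-injective : ∀ p q → p < n → q < n → L p ≡ L q → p ≡ q)
                  (V-beyond : ∀ p → n ≤ p → V p ≡ 0) where

    δ : ℕ → ℕ
    δ = descent n L

    record Block (s : ℕ) : Set where
      field
        top        : ∀ p → p < s → V p ≡ suc M
        increasing : Ascending s L
        rest-chain : Chain (n ∸ s) (descent (n ∸ s) (λ p → L (s + p))) (λ p → V (s + p))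
        rest-bound : Bounded (n ∸ s) (λ p → V (s + p)) M

    suffix-step : ∀ s → s ≤ n → ∀ q →
      V (s + suc q) + descent (n ∸ s) (λ p → L (s + p)) q ≡ V (suc (s + q)) + δ (s + q)
    suffix-step s s≤n q = cong₂ _+_ (cong V (+-suc s q)) (descent-shift n s L q s≤n)

    suffix< : ∀ s → s ≤ n → ∀ q → q < n ∸ s → s + q < n
    suffix< s s≤n q q<n∸s = subst (s + q <_) (m+[n∸m]≡n s≤n) (+-monoʳ-< s q<n∸s)

    <suffix : ∀ s q → s + q < n → q < n ∸ s
    <suffix s q s+q<n = subst (_< n ∸ s) (m+n∸m≡n s q) (∸-monoˡ-< s+q<n (m≤m+n s q))

    block-end≤ : ∀ s → s ≤ n → Block s → V s ≤ M
    block-end≤ s s≤n b with s <? n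
    ... | yes s<n = subst (_≤ M) (cong V (+-identityʳ s)) (Block.rest-bound b 0 (m<n⇒0<n∸m s<n))
    ... | no  s≮n = subst (_≤ M) (sym (V-beyond s (≮⇒≥ s≮n))) z≤n

    block-unique : ∀ s s′ → s ≤ n → s′ ≤ n → Block s → Block s′ → s ≡ s′
    block-unique s s′ s≤n s′≤n b b′ with <-cmp s s′
    ... | tri≈ _ s≡s′ _ = s≡s′
    ... | tri< s<s′ _ _ = ⊥-elim (<⇒≱ (s≤s (block-end≤ s s≤n b)) (≤-reflexive (sym (Block.top b′ s s<s′))))
    ... | tri> _ _ s′<s = ⊥-elim (<⇒≱ (s≤s (block-end≤ s′ s′≤n b′)) (≤-reflexive (sym (Block.top b s′ s′<s))))

    block⇒chain : ∀ s → s ≤ n → Block s → Chain n δ V × Bounded n V (suc M)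
    block⇒chain s s≤n b = chain , bound
      where
      open Block b
      chain : Chain n δ V
      chain p p<n with <-cmp (suc p) s
      ... | tri< 1+p<s _ _ rewrite top (suc p) 1+p<s | top p (<-trans (n<1+n p) 1+p<s)
                                 | descent-ascent n L p (λ _ → increasing p 1+p<s) = ≤-reflexive (+-identityʳ _)
      ... | tri≈ _ refl _ rewrite top p ≤-refl =
        ≤-trans (+-mono-≤ (block-end≤ (suc p) s≤n b) (descent≤1 n L p)) (≤-reflexive (+-comm M 1))
      ... | tri> _ _ s<1+p with m≤n⇒∃[o]m+o≡n (s≤s⁻¹ s<1+p)
      ...   | q , refl = subst (_≤ V (s + q)) (suffix-step s s≤n q) (rest-chain q (<suffix s q p<n))
      bound : Bounded n V (suc M)
      bound p p<n with p <? s
      ... | yes p<s = ≤-reflexive (top p p<s)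
      ... | no  p≮s with m≤n⇒∃[o]m+o≡n (≮⇒≥ p≮s)
      ...   | q , refl = m≤n⇒m≤1+n (rest-bound q (<suffix s q p<n))

    chain⇒block : Chain n δ V → Bounded n V (suc M) → ∃ λ s → s ≤ n × Block s
    chain⇒block chain bound = s , s≤n , record
      { top = top ; increasing = increasing ; rest-chain = rest-chain ; rest-bound = rest-bound }
      where
      below : ℕ → Bool
      below p = V p ≤ᵇ M
      s = firstᵇ n below
      s≤n = firstᵇ≤ n below
      top : ∀ p → p < s → V p ≡ suc M
      top p p<s = ≤-antisym (bound p (<-≤-trans p<s s≤n)) (≰⇒> (λ Vp≤M → firstᵇ-minimal n below p p<s (≤⇒≤ᵇ Vp≤M)))
      increasing : Ascending s L
      increasing p 1+p<s = ≤∧≢⇒< (≮⇒≥ no-descent) (λ Lp≡Lp+1 → 1+n≢n (sym (L-injective p (suc p) p<n 1+p<n Lp≡Lp+1)))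
        where
        1+p<n = <-≤-trans 1+p<s s≤n
        p<n = <-trans (n<1+n p) 1+p<n
        no-descent : ¬ L (suc p) < L p
        no-descent Lp+1<Lp = 1+n≰n (begin
          suc (suc M)      ≡⟨ +-comm 1 (suc M) ⟩
          suc M + 1        ≡⟨ cong₂ _+_ (sym (top (suc p) 1+p<s)) (sym (descent-descent n L p 1+p<n Lp+1<Lp)) ⟩
          V (suc p) + δ p  ≤⟨ chain p p<n ⟩
          V p              ≡⟨ top p (<-trans (n<1+n p) 1+p<s) ⟩
          suc M            ∎)
          where open ≤-Reasoning
      rest-chain : Chain (n ∸ s) (descent (n ∸ s) (λ p → L (s + p))) (λ p → V (s + p))
      rest-chain q q<n∸s = subst (_≤ V (s + q)) (sym (suffix-step s s≤n q)) (chain (s + q) (suffix< s s≤n q q<n∸s))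
      rest-bound : Bounded (n ∸ s) (λ p → V (s + p)) M
      rest-bound q q<n∸s = ≤-trans (stepwise-antitone V (s + q) steps s (m≤m+n s q)) (≤ᵇ⇒≤ _ _ (firstᵇ-found n below s<n))
        where
        s+q<n = suffix< s s≤n q q<n∸s
        s<n = ≤-<-trans (m≤m+n s q) s+q<n
        steps : ∀ r → r < s + q → V (suc r) ≤ V r
        steps r r<s+q = ≤-trans (m≤m+n _ _) (chain r (<-trans r<s+q s+q<n))

  letter : ∀ {s n} → (Fin s → Fin n) → ℕ → ℕ
  letter u = at (toℕ ∘ u)

  weight : ∀ {s n} → (Fin s → Fin n) → (Fin n → ℕ) → ℕ → ℕ
  weight u E = at (E ∘ u)

  weight-cong : ∀ {s n} (u : Fin s → Fin n) {E E′ : Fin n → ℕ} → (∀ q → E (u q) ≡ E′ (u q)) →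
    ∀ p → weight u E p ≡ weight u E′ p
  weight-cong u {E} {E′} E≗E′ = at-map (E′ ∘ u) (E ∘ u) (λ _ x → x) E≗E′ (λ _ → refl)

  letter-injective : ∀ {s n} (u : Fin s → Fin n) → Injective _≡_ _≡_ u →
    ∀ p q → p < s → q < s → letter u p ≡ letter u q → p ≡ q
  letter-injective u inj p q p<s q<s eq = trans (sym (toℕ-fromℕ< p<s)) (trans (cong toℕ (inj (toℕ-injective
    (trans (sym (at-< _ p p<s)) (trans eq (at-< _ q q<s)))))) (toℕ-fromℕ< q<s))

  ascending⇒increasing : ∀ {s n} (u : Fin s → Fin n) → Ascending s (letter u) → Increasing u
  ascending⇒increasing {s} u asc a b a<b =
    subst₂ _<_ (at-toℕ _ a) (at-toℕ _ b) (stepwise-increasing (letter u) s asc (toℕ a) (toℕ b) a<b (toℕ<n b))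

  ascending⇒st≡id : ∀ {s n} (u : Fin s → Fin n) → Ascending s (letter u) → ∀ i → st u i ≡ i
  ascending⇒st≡id u asc = st-increasing u (ascending⇒increasing u asc)

  st≡id⇒ascending : ∀ {s n} (u : Fin s → Fin n) → Injective _≡_ _≡_ u → (∀ i → st u i ≡ i) → Ascending s (letter u)
  st≡id⇒ascending u inj st≡id p 1+p<s = subst₂ _<_ (sym (at-< _ p p<s)) (sym (at-< _ (suc p) 1+p<s))
    (st-<-reflect u inj (fromℕ< p<s) (fromℕ< 1+p<s) (subst₂ _<_ (sym (st-at p<s)) (sym (st-at 1+p<s)) (n<1+n p)))
    where
    p<s = <-trans (n<1+n p) 1+p<s
    st-at : ∀ {q} (q<s : q < _) → toℕ (st u (fromℕ< q<s)) ≡ q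
    st-at q<s = trans (cong toℕ (st≡id _)) (toℕ-fromℕ< q<s)

  ascending⇒id : ∀ {n} (σ : Fin n → Fin n) → Ascending n (letter σ) → ∀ i → σ i ≡ i
  ascending⇒id {n} σ asc i = toℕ-injective (trans (sym (at-toℕ _ i))
    (ascending-bounded⇒id n (letter σ) asc (λ p p<n → subst (_< n) (sym (at-< _ p p<n)) (toℕ<n _)) (toℕ i) (toℕ<n i)))

  id⇒ascending : ∀ {n} (σ : Fin n → Fin n) → (∀ i → σ i ≡ i) → Ascending n (letter σ)
  id⇒ascending σ σ≗id p 1+p<n = subst₂ _<_ (sym (letter-id p p<n)) (sym (letter-id (suc p) 1+p<n)) (n<1+n p)
    where
    p<n = <-trans (n<1+n p) 1+p<n
    letter-id : ∀ q q<n → letter σ q ≡ q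
    letter-id q q<n = trans (at-< _ q q<n) (trans (cong toℕ (σ≗id _)) (toℕ-fromℕ< q<n))

  isIdᵇ⁻ : ∀ {n} (w : Fin n → Fin n) → T (isIdᵇ w) → ∀ i → w i ≡ i
  isIdᵇ⁻ w h i = toℕ-injective (≡ᵇ⇒≡ _ _ (allᵇ⁻ (λ i → w i ==ᶠ i) h i))

  isIdᵇ⁺ : ∀ {n} (w : Fin n → Fin n) → (∀ i → w i ≡ i) → T (isIdᵇ w)
  isIdᵇ⁺ w w≗id = allᵇ⁺ (λ i → w i ==ᶠ i) (λ i → ≡⇒≡ᵇ _ _ (cong toℕ (w≗id i)))

  -- The exponent vector of x_{w(1)} ⋯ x_{w(j)}, so that P w j is mono (prefixExp w j).
  prefixExp : ∀ {s n} → (Fin s → Fin n) → ℕ → Fin n → ℕ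
  prefixExp w j v = [ anyᵇ (λ k → (toℕ k <ᵇ j) ∧ (w k ==ᶠ v)) ]ℕ

  prefixExp-at : ∀ {s n} (w : Fin s → Fin n) → Injective _≡_ _≡_ w → ∀ j q → prefixExp w j (w q) ≡ [ toℕ q <ᵇ j ]ℕ
  prefixExp-at w inj j q = cong [_]ℕ (T-ext
    (λ h → let k , k<j∧wk≡wq = anyᵇ⁻ (λ k → (toℕ k <ᵇ j) ∧ (w k ==ᶠ w q)) h
               k<j , wk≡wq = T-∧⁻ {toℕ k <ᵇ j} k<j∧wk≡wq
           in subst (λ x → T (toℕ x <ᵇ j)) (inj (toℕ-injective (≡ᵇ⇒≡ (toℕ (w k)) (toℕ (w q)) wk≡wq))) k<j)
    (λ q<j → anyᵇ⁺ (λ k → (toℕ k <ᵇ j) ∧ (w k ==ᶠ w q)) q (T-∧⁺ q<j (≡⇒≡ᵇ (toℕ (w q)) _ refl))))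

  0ᵉ : ∀ {n} → Fin n → ℕ
  0ᵉ _ = 0

  _+ᵉ_ _∸ᵉ_ : ∀ {n} → (Fin n → ℕ) → (Fin n → ℕ) → Fin n → ℕ
  (e +ᵉ e′) v = e v + e′ v
  (e ∸ᵉ e′) v = e v ∸ e′ v

  _≤ᵉ_ : ∀ {n} → (Fin n → ℕ) → (Fin n → ℕ) → Bool
  e ≤ᵉ E = allᵇ (λ v → e v ≤ᵇ E v)

  0ᵉ≤ᵉ : ∀ {n} (E : Fin n → ℕ) → T (0ᵉ ≤ᵉ E)
  0ᵉ≤ᵉ E = allᵇ⁺ (λ v → 0 ≤ᵇ E v) (λ _ → tt)

  ≤ᵉ-suc : ∀ {n} (e E : Fin (suc n) → ℕ) → (e ≤ᵉ E) ≡ (e Fin.zero ≤ᵇ E Fin.zero) ∧ (tail e ≤ᵉ tail E)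
  ≤ᵉ-suc e E = allᵇ-suc (λ v → e v ≤ᵇ E v)

  allᵇ-∧ : ∀ {n} (p q : Fin n → Bool) → allᵇ (λ v → p v ∧ q v) ≡ allᵇ p ∧ allᵇ q
  allᵇ-∧ p q = T-ext
    (λ h → T-∧⁺ (allᵇ⁺ p (λ v → proj₁ (T-∧⁻ {p v} (allᵇ⁻ _ h v)))) (allᵇ⁺ q (λ v → proj₂ (T-∧⁻ {p v} (allᵇ⁻ _ h v)))))
    (λ h → let hp , hq = T-∧⁻ {allᵇ p} h in allᵇ⁺ _ (λ v → T-∧⁺ (allᵇ⁻ p hp v) (allᵇ⁻ q hq v)))

  ≡ᵇ-+ : ∀ m k j → (m ≡ᵇ k + j) ≡ (j ≤ᵇ m) ∧ (m ∸ j ≡ᵇ k)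
  ≡ᵇ-+ m k j = T-ext
    (λ h → let m≡k+j = ≡ᵇ⇒≡ m (k + j) h in
           T-∧⁺ (≤⇒≤ᵇ (subst (j ≤_) (sym m≡k+j) (m≤n+m j k))) (≡⇒≡ᵇ (m ∸ j) k (trans (cong (_∸ j) m≡k+j) (m+n∸n≡m k j))))
    (λ h → let j≤m , m∸j≡k = T-∧⁻ {j ≤ᵇ m} h in
           ≡⇒≡ᵇ m (k + j) (trans (sym (m∸n+n≡m (≤ᵇ⇒≤ j m j≤m))) (cong (_+ j) (≡ᵇ⇒≡ (m ∸ j) k m∸j≡k))))

  +-≤ᵇ : ∀ m k j → (k + j ≤ᵇ m) ≡ (j ≤ᵇ m) ∧ (k ≤ᵇ m ∸ j)
  +-≤ᵇ m k j = T-ext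
    (λ h → let k+j≤m = ≤ᵇ⇒≤ (k + j) m h in T-∧⁺ (≤⇒≤ᵇ (m+n≤o⇒n≤o k k+j≤m)) (≤⇒≤ᵇ (m+n≤o⇒m≤o∸n k k+j≤m)))
    (λ h → let j≤m , k≤m∸j = T-∧⁻ {j ≤ᵇ m} h in
           ≤⇒≤ᵇ (subst (k + j ≤_) (m∸n+n≡m (≤ᵇ⇒≤ j m j≤m)) (+-monoˡ-≤ j (≤ᵇ⇒≤ k (m ∸ j) k≤m∸j))))

  +ᵉ-≤ᵉ : ∀ {n} (e χ E : Fin n → ℕ) → ((e +ᵉ χ) ≤ᵉ E) ≡ (χ ≤ᵉ E) ∧ (e ≤ᵉ (E ∸ᵉ χ))
  +ᵉ-≤ᵉ e χ E = trans (allᵇ-cong (λ v → +-≤ᵇ (E v) (e v) (χ v))) (allᵇ-∧ (λ v → χ v ≤ᵇ E v) (λ v → e v ≤ᵇ E v ∸ χ v))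

  tightAlongᵇ : ∀ {s n} → ℕ → (Fin s → Fin n) → (Fin n → ℕ) → Bool
  tightAlongᵇ {s} i u E = tightᵇ s (descent s (letter u)) i (weight u E)

  chainAlongᵇ : ∀ {s n} → (Fin s → Fin n) → (Fin n → ℕ) → Bool
  chainAlongᵇ u E = tightAlongᵇ 0 u E

  boundedAlongᵇ : ∀ {s n} → (Fin s → Fin n) → (Fin n → ℕ) → ℕ → Bool
  boundedAlongᵇ {s} u E M = boundedᵇ s (weight u E) M

  tightAlongᵇ-cong : ∀ {s n} i (u : Fin s → Fin n) {E E′ : Fin n → ℕ} → (∀ q → E (u q) ≡ E′ (u q)) →
    tightAlongᵇ i u E ≡ tightAlongᵇ i u E′
  tightAlongᵇ-cong {s} i u {E} {E′} E≗E′ = tightᵇ-cong s i (λ _ _ → refl) (weight-cong u {E} {E′} E≗E′)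

  boundedAlongᵇ-cong : ∀ {s n} (u : Fin s → Fin n) {E E′ : Fin n → ℕ} M → (∀ q → E (u q) ≡ E′ (u q)) →
    boundedAlongᵇ u E M ≡ boundedAlongᵇ u E′ M
  boundedAlongᵇ-cong {s} u {E} {E′} M E≗E′ = boundedᵇ-cong s M (λ p _ → weight-cong u {E} {E′} E≗E′ p)

  letterᵇ : ∀ {s n} → (Fin s → Fin n) → Fin n → Bool
  letterᵇ u x = anyᵇ (λ i → u i ==ᶠ x)

  letterᵇ⁻ : ∀ {s n} (u : Fin s → Fin n) x → T (letterᵇ u x) → ∃ λ i → u i ≡ x
  letterᵇ⁻ u x h = let i , ui≡x = anyᵇ⁻ (λ i → u i ==ᶠ x) h in i , toℕ-injective (≡ᵇ⇒≡ _ _ ui≡x)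

  letterᵇ⁺ : ∀ {s n} (u : Fin s → Fin n) i → T (letterᵇ u (u i))
  letterᵇ⁺ u i = anyᵇ⁺ (λ i′ → u i′ ==ᶠ u i) i (≡⇒≡ᵇ (toℕ (u i)) _ refl)

  supportedᵇ : ∀ {s n} → (Fin s → Fin n) → (Fin n → ℕ) → Bool
  supportedᵇ u E = allᵇ (λ x → (E x ≡ᵇ 0) ∨ letterᵇ u x)

  -- The exponent vector at which substW u f evaluates f.
  pullback : ∀ {s n} → (Fin s → Fin n) → (Fin n → ℕ) → Fin s → ℕ
  pullback u E k = sumℕ (λ j → if st u j ==ᶠ k then E (u j) else 0)

  pullback-st : ∀ {s n} (u : Fin s → Fin n) → Injective _≡_ _≡_ u → ∀ E q → pullback u E (st u q) ≡ E (u q)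
  pullback-st u inj E q = trans
    (sumℕ-single _ q (λ j j≢q → cong (λ b → if b then E (u j) else 0)
      (¬T⇒≡false (λ h → j≢q (st-injective u inj (toℕ-injective (≡ᵇ⇒≡ _ _ h)))))))
    (cong (λ b → if b then E (u q) else 0) (T⇒≡true (≡⇒≡ᵇ (toℕ (st u q)) _ refl)))

  supportedᵇ-cong : ∀ {s n} (u : Fin s → Fin n) {E E′ : Fin n → ℕ} → (∀ v → E v ≡ E′ v) → supportedᵇ u E ≡ supportedᵇ u E′
  supportedᵇ-cong u E≗E′ = allᵇ-cong (λ x → cong (λ y → (y ≡ᵇ 0) ∨ letterᵇ u x) (E≗E′ x))

  pullback-cong : ∀ {s n} (u : Fin s → Fin n) {E E′ : Fin n → ℕ} → (∀ v → E v ≡ E′ v) →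
    ∀ k → pullback u E k ≡ pullback u E′ k
  pullback-cong u E≗E′ k = sumℕ-cong (λ j → cong (λ y → if st u j ==ᶠ k then y else 0) (E≗E′ (u j)))

  weight-st : ∀ {s n} (u : Fin s → Fin n) → Injective _≡_ _≡_ u → ∀ E p → weight (st u) (pullback u E) p ≡ weight u E p
  weight-st u inj E = at-map (E ∘ u) (pullback u E ∘ st u) (λ _ x → x) (pullback-st u inj E) (λ _ → refl)

  tightAlongᵇ-st : ∀ {s n} i (u : Fin s → Fin n) → Injective _≡_ _≡_ u → ∀ E →
    tightAlongᵇ i (st u) (pullback u E) ≡ tightAlongᵇ i u E
  tightAlongᵇ-st {s} i u inj E = tightᵇ-cong s i (λ p _ → descent-cong s {letter (st u)} {letter u} same-order p) (weight-st u inj E)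
    where
    same-order : ∀ p → suc p < s → (letter (st u) (suc p) <ᵇ letter (st u) p) ≡ (letter u (suc p) <ᵇ letter u p)
    same-order p 1+p<s = trans (cong₂ _<ᵇ_ (at-< _ (suc p) 1+p<s) (at-< _ p p<s))
                        (trans (st-<ᶠ u inj _ _) (sym (cong₂ _<ᵇ_ (at-< _ (suc p) 1+p<s) (at-< _ p p<s))))
      where p<s = <-trans (n<1+n p) 1+p<s

  boundedAlongᵇ-st : ∀ {s n} (u : Fin s → Fin n) → Injective _≡_ _≡_ u → ∀ E M →
    boundedAlongᵇ (st u) (pullback u E) M ≡ boundedAlongᵇ u E M
  boundedAlongᵇ-st {s} u inj E M = boundedᵇ-cong s M (λ p _ → weight-st u inj E p)

  record Partition {s t n} (u : Fin s → Fin n) (v : Fin t → Fin n) : Set where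
    field
      disjoint : ∀ i j → u i ≢ v j
      cover    : ∀ x → (∃ λ i → u i ≡ x) ⊎ (∃ λ j → v j ≡ x)

  blockExp : ∀ {s n} → (Fin s → Fin n) → ℕ → Fin n → ℕ
  blockExp u m x = if letterᵇ u x then m else 0

  blockExp-letter : ∀ {s n} (u : Fin s → Fin n) m i → blockExp u m (u i) ≡ m
  blockExp-letter u m i = cong (λ b → if b then m else 0) (T⇒≡true (letterᵇ⁺ u i))

  blockExp-nonletter : ∀ {s n} (u : Fin s → Fin n) m x → ¬ T (letterᵇ u x) → blockExp u m x ≡ 0
  blockExp-nonletter u m x ¬letter = cong (λ b → if b then m else 0) (¬T⇒≡false ¬letter)

  supported∧block≡blockExp : ∀ {s n} (u : Fin s → Fin n) E m →
    supportedᵇ u E ∧ allᵇ (λ i → E (u i) ≡ᵇ m) ≡ allᵇ (λ x → E x ≡ᵇ blockExp u m x)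
  supported∧block≡blockExp u E m = T-ext
    (λ h → let supported , block = T-∧⁻ {supportedᵇ u E} h in allᵇ⁺ _ (λ x → exact supported block x (T? (letterᵇ u x))))
    (λ h → let E≡blockExp x = ≡ᵇ⇒≡ (E x) _ (allᵇ⁻ _ h x) in
      T-∧⁺ (allᵇ⁺ _ (λ x → supported (E≡blockExp x) (T? (letterᵇ u x))))
           (allᵇ⁺ _ (λ i → ≡⇒≡ᵇ (E (u i)) m (trans (E≡blockExp (u i)) (blockExp-letter u m i)))))
    where
    exact : T (supportedᵇ u E) → T (allᵇ (λ i → E (u i) ≡ᵇ m)) → ∀ x → Dec (T (letterᵇ u x)) → T (E x ≡ᵇ blockExp u m x)
    exact _ block x (yes letter) with letterᵇ⁻ u x letter
    ... | i , refl = subst (λ y → T (E (u i) ≡ᵇ y)) (sym (blockExp-letter u m i)) (allᵇ⁻ _ block i)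
    exact supported _ x (no ¬letter) with Equivalence.to T-∨ (allᵇ⁻ _ supported x)
    ... | inj₁ Ex≡0  = subst (λ y → T (E x ≡ᵇ y)) (sym (blockExp-nonletter u m x ¬letter)) Ex≡0
    ... | inj₂ letter = ⊥-elim (¬letter letter)
    supported : ∀ {x} → E x ≡ blockExp u m x → Dec (T (letterᵇ u x)) → T ((E x ≡ᵇ 0) ∨ letterᵇ u x)
    supported _             (yes letter) = Equivalence.from T-∨ (inj₂ letter)
    supported {x} E≡blockExp (no ¬letter) =
      Equivalence.from T-∨ (inj₁ (≡⇒≡ᵇ (E x) 0 (trans E≡blockExp (blockExp-nonletter u m x ¬letter))))

  module _ {s t n} {u : Fin s → Fin n} {v : Fin t → Fin n} (partition : Partition u v) (m : ℕ) where
    open Partition partition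

    blockExp-off : ∀ j → blockExp u m (v j) ≡ 0
    blockExp-off j = blockExp-nonletter u m (v j) (λ letter → let i , ui≡vj = letterᵇ⁻ u (v j) letter in disjoint i j ui≡vj)

    block-split : ∀ E → (blockExp u m ≤ᵉ E) ∧ supportedᵇ v (E ∸ᵉ blockExp u m) ≡ allᵇ (λ i → E (u i) ≡ᵇ m)
    block-split E = T-ext
      (λ h → let below , supported = T-∧⁻ {blockExp u m ≤ᵉ E} h in
             allᵇ⁺ _ (λ i → ≡⇒≡ᵇ (E (u i)) m (≤-antisym (at-most supported i) (at-least below i))))
      (λ h → T-∧⁺ (allᵇ⁺ _ (λ x → below (≡ᵇ⇒≡ _ _ ∘ allᵇ⁻ _ h) x (cover x)))
                  (allᵇ⁺ _ (λ x → supported (≡ᵇ⇒≡ _ _ ∘ allᵇ⁻ _ h) x (cover x))))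
      where
      at-least : T (blockExp u m ≤ᵉ E) → ∀ i → m ≤ E (u i)
      at-least below i = subst (_≤ E (u i)) (blockExp-letter u m i) (≤ᵇ⇒≤ _ _ (allᵇ⁻ _ below (u i)))
      at-most : T (supportedᵇ v (E ∸ᵉ blockExp u m)) → ∀ i → E (u i) ≤ m
      at-most supported i with Equivalence.to T-∨ (allᵇ⁻ _ supported (u i))
      ... | inj₁ rest≡0 = m∸n≡0⇒m≤n (trans (cong (E (u i) ∸_) (sym (blockExp-letter u m i))) (≡ᵇ⇒≡ _ _ rest≡0))
      ... | inj₂ letter = let j , vj≡ui = letterᵇ⁻ v (u i) letter in ⊥-elim (disjoint i j (sym vj≡ui))
      below : (∀ i → E (u i) ≡ m) → ∀ x → (∃ λ i → u i ≡ x) ⊎ (∃ λ j → v j ≡ x) → T (blockExp u m x ≤ᵇ E x)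
      below Eu≡m _ (inj₁ (i , refl)) = ≤⇒≤ᵇ (≤-reflexive (trans (blockExp-letter u m i) (sym (Eu≡m i))))
      below Eu≡m _ (inj₂ (j , refl)) rewrite blockExp-off j = tt
      supported : (∀ i → E (u i) ≡ m) → ∀ x → (∃ λ i → u i ≡ x) ⊎ (∃ λ j → v j ≡ x) →
        T (((E ∸ᵉ blockExp u m) x ≡ᵇ 0) ∨ letterᵇ v x)
      supported Eu≡m _ (inj₁ (i , refl)) = Equivalence.from T-∨ (inj₁ (≡⇒≡ᵇ _ 0
        (trans (cong₂ _∸_ (Eu≡m i) (blockExp-letter u m i)) (n∸n≡0 m))))
      supported Eu≡m _ (inj₂ (j , refl)) = Equivalence.from T-∨ (inj₂ (letterᵇ⁺ v j))

module PowerSeries {c ℓ} (K : CommutativeRing c ℓ) where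

  open import Data.Bool using (Bool; true; false; if_then_else_; _∧_; T)
  open import Data.Empty using (⊥-elim)
  open import Data.Fin as Fin using ()
  open import Data.List using (List; []; _++_; map) renaming (_∷_ to _∷ₗ_)
  open import Data.Nat as ℕ using (zero; suc; _∸_; _<_; _≡ᵇ_; _≤ᵇ_; z≤n; s≤s; s≤s⁻¹; _≤?_)
  open import Data.Nat.Properties as ℕ using (≡ᵇ⇒≡; ≡⇒≡ᵇ; ≤ᵇ⇒≤; ≤⇒≤ᵇ)
  open import Data.Product using (proj₁; proj₂)
  open import Data.Vec.Functional using (_∷_; tail)
  open import Function using (_∘_)
  import Relation.Binary.PropositionalEquality as ≡
  open ≡ using (_≢_)
  open import Relation.Nullary using (¬_; yes; no)

  open Combinatorics
  open CommutativeRing K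
  open Over K
  open import Relation.Binary.Reasoning.Setoid setoid
  open import Algebra.Properties.Ring ring using (-‿distribˡ-*; -0#≈0#)
  open import Algebra.Properties.AbelianGroup +-abelianGroup using (⁻¹-∙-comm)
  open import Algebra.Properties.CommutativeSemigroup +-commutativeSemigroup using (interchange)
  open import Algebra.Properties.CommutativeSemigroup *-commutativeSemigroup using (x∙yz≈y∙xz)

  [_] : Bool → Carrier
  [ b ] = if b then 1# else 0#

  []-true : ∀ {b} → T b → [ b ] ≡ 1#
  []-true {true} _ = ≡.refl

  []-false : ∀ {b} → ¬ T b → [ b ] ≡ 0#
  []-false {false} _ = ≡.refl
  []-false {true}  h = ⊥-elim (h _)

  []-∧ : ∀ a b → [ a ∧ b ] ≈ [ a ] * [ b ]
  []-∧ true  b = sym (*-identityˡ _)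
  []-∧ false b = sym (zeroˡ _)

  []*-true : ∀ {b} x → T b → [ b ] * x ≈ x
  []*-true x h rewrite []-true h = *-identityˡ x

  []*-false : ∀ {b} x → ¬ T b → [ b ] * x ≈ 0#
  []*-false x h rewrite []-false h = zeroˡ x

  []-cong : ∀ {a b} → (T a → T b) → (T b → T a) → [ a ] ≈ [ b ]
  []-cong a⇒b b⇒a = reflexive (≡.cong [_] (T-ext a⇒b b⇒a))

  if-then-0 : ∀ b x → (if b then x else 0#) ≈ [ b ] * x
  if-then-0 true  x = sym (*-identityˡ x)
  if-then-0 false x = sym (zeroˡ x)

  Σᴷ-suc : ∀ {n} (f : Fin (suc n) → Carrier) → Σᴷ f ≡ f Fin.zero + Σᴷ (f ∘ Fin.suc)
  Σᴷ-suc = foldr-allFin-suc _+_ 0#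

  Σᴷ-zero : ∀ {n} (f : Fin n → Carrier) → (∀ i → f i ≈ 0#) → Σᴷ f ≈ 0#
  Σᴷ-zero {zero}  f h = refl
  Σᴷ-zero {suc n} f h rewrite Σᴷ-suc f = trans (+-cong (h Fin.zero) (Σᴷ-zero (f ∘ Fin.suc) (h ∘ Fin.suc))) (+-identityˡ 0#)

  Σᴷ-single : ∀ {n} (f : Fin n → Carrier) i₀ → (∀ i → i ≢ i₀ → f i ≈ 0#) → Σᴷ f ≈ f i₀
  Σᴷ-single f Fin.zero h rewrite Σᴷ-suc f =
    trans (+-congˡ (Σᴷ-zero (f ∘ Fin.suc) (λ i → h (Fin.suc i) (λ ())))) (+-identityʳ _)
  Σᴷ-single f (Fin.suc i₀) h rewrite Σᴷ-suc f =
    trans (+-congʳ (h Fin.zero (λ ()))) (trans (+-identityˡ _)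
      (Σᴷ-single (f ∘ Fin.suc) i₀ (λ i i≢i₀ → h (Fin.suc i) (λ { ≡.refl → i≢i₀ ≡.refl }))))

  ΣᴷupTo-suc : ∀ m (f : ℕ → Carrier) → ΣᴷupTo (suc m) f ≡ f 0 + ΣᴷupTo m (f ∘ suc)
  ΣᴷupTo-suc = foldr-upTo-suc _+_ 0#

  ΣᴷupTo-cong : ∀ N {f g : ℕ → Carrier} → (∀ a → a < N → f a ≈ g a) → ΣᴷupTo N f ≈ ΣᴷupTo N g
  ΣᴷupTo-cong zero            h = refl
  ΣᴷupTo-cong (suc N) {f} {g} h rewrite ΣᴷupTo-suc N f | ΣᴷupTo-suc N g =
    +-cong (h 0 (s≤s z≤n)) (ΣᴷupTo-cong N (λ a a<N → h (suc a) (s≤s a<N)))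

  ΣᴷupTo-zero : ∀ N (f : ℕ → Carrier) → (∀ a → a < N → f a ≈ 0#) → ΣᴷupTo N f ≈ 0#
  ΣᴷupTo-zero zero    f h = refl
  ΣᴷupTo-zero (suc N) f h rewrite ΣᴷupTo-suc N f =
    trans (+-cong (h 0 (s≤s z≤n)) (ΣᴷupTo-zero N (f ∘ suc) (λ a a<N → h (suc a) (s≤s a<N)))) (+-identityˡ 0#)

  ΣᴷupTo-single : ∀ N (f : ℕ → Carrier) a₀ → a₀ < N → (∀ a → a < N → a ≢ a₀ → f a ≈ 0#) → ΣᴷupTo N f ≈ f a₀
  ΣᴷupTo-single (suc N) f zero _ h rewrite ΣᴷupTo-suc N f =
    trans (+-congˡ (ΣᴷupTo-zero N (f ∘ suc) (λ a a<N → h (suc a) (s≤s a<N) (λ ())))) (+-identityʳ _)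
  ΣᴷupTo-single (suc N) f (suc a₀) (s≤s a₀<N) h rewrite ΣᴷupTo-suc N f =
    trans (+-congʳ (h 0 (s≤s z≤n) (λ ()))) (trans (+-identityˡ _)
      (ΣᴷupTo-single N (f ∘ suc) a₀ a₀<N (λ a a<N a≢a₀ → h (suc a) (s≤s a<N) (a≢a₀ ∘ ℕ.suc-injective))))

  ΣᴷupTo-+ : ∀ N (f g : ℕ → Carrier) → ΣᴷupTo N (λ a → f a + g a) ≈ ΣᴷupTo N f + ΣᴷupTo N g
  ΣᴷupTo-+ zero    f g = sym (+-identityˡ 0#)
  ΣᴷupTo-+ (suc N) f g rewrite ΣᴷupTo-suc N (λ a → f a + g a) | ΣᴷupTo-suc N f | ΣᴷupTo-suc N g =
    trans (+-congˡ (ΣᴷupTo-+ N (f ∘ suc) (g ∘ suc))) (interchange _ _ _ _)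

  ΣᴷupTo-*ˡ : ∀ N x (f : ℕ → Carrier) → ΣᴷupTo N (λ a → x * f a) ≈ x * ΣᴷupTo N f
  ΣᴷupTo-*ˡ zero    x f = sym (zeroʳ x)
  ΣᴷupTo-*ˡ (suc N) x f rewrite ΣᴷupTo-suc N (λ a → x * f a) | ΣᴷupTo-suc N f =
    trans (+-congˡ (ΣᴷupTo-*ˡ N x (f ∘ suc))) (sym (distribˡ x _ _))

  ΣᴷupTo-select : ∀ N (P : ℕ → Bool) (f : ℕ → Carrier) a₀ → a₀ < N → T (P a₀) → (∀ a → a < N → T (P a) → a ≡ a₀) →
    ΣᴷupTo N (λ a → [ P a ] * f a) ≈ f a₀
  ΣᴷupTo-select N P f a₀ a₀<N Pa₀ unique =
    trans (ΣᴷupTo-single N _ a₀ a₀<N (λ a a<N a≢a₀ → []*-false _ (a≢a₀ ∘ unique a a<N))) ([]*-true _ Pa₀)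

  ΣᴷupTo-none : ∀ N (P : ℕ → Bool) (f : ℕ → Carrier) → (∀ a → a < N → ¬ T (P a)) → ΣᴷupTo N (λ a → [ P a ] * f a) ≈ 0#
  ΣᴷupTo-none N P f none = ΣᴷupTo-zero N _ (λ a a<N → []*-false _ (none a a<N))

  ΣᴷupTo-indicator : ∀ E0 e0 (P : ℕ → Bool) (g : ℕ → Carrier) a₀ →
    (e0 ≤ E0 → a₀ ≤ E0 × T (P a₀)) → (∀ a → a ≤ E0 → T (P a) → e0 ≤ E0 × a ≡ a₀) →
    ΣᴷupTo (suc E0) (λ a → [ P a ] * g a) ≈ [ e0 ≤ᵇ E0 ] * g a₀
  ΣᴷupTo-indicator E0 e0 P g a₀ exists unique with e0 ≤? E0
  ... | yes e0≤E0 = trans (ΣᴷupTo-select (suc E0) P g a₀ (s≤s (proj₁ (exists e0≤E0))) (proj₂ (exists e0≤E0))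
                            (λ a a<1+E0 Pa → proj₂ (unique a (s≤s⁻¹ a<1+E0) Pa)))
                          (sym ([]*-true _ (≤⇒≤ᵇ e0≤E0)))
  ... | no  e0≰E0 = trans (ΣᴷupTo-none (suc E0) P g (λ a a<1+E0 Pa → e0≰E0 (proj₁ (unique a (s≤s⁻¹ a<1+E0) Pa))))
                          (sym ([]*-false _ (e0≰E0 ∘ ≤ᵇ⇒≤ _ _)))

  Extensional : ∀ {n} → Ser n → Set ℓ
  Extensional {n} f = ∀ {E E′ : Fin n → ℕ} → (∀ v → E v ≡ E′ v) → f E ≈ f E′

  extensional-∷ : ∀ {n} {f : Ser (suc n)} a → Extensional f → Extensional (λ e → f (a ∷ e))
  extensional-∷ a ext E≗E′ = ext (λ { Fin.zero → ≡.refl ; (Fin.suc v) → E≗E′ v })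

  ≈ˢ-extensional : ∀ {n} {f g : Ser n} → f ≈ˢ g → Extensional g → Extensional f
  ≈ˢ-extensional {f = f} {g} f≈g ext {E} {E′} E≗E′ = trans (f≈g E) (trans (ext E≗E′) (sym (f≈g E′)))

  ·ˢ-congˡ : ∀ {n} {f f′ : Ser n} (g : Ser n) → f ≈ˢ f′ → (f ·ˢ g) ≈ˢ (f′ ·ˢ g)
  ·ˢ-congˡ {zero}  g f≈f′ E = *-congʳ (f≈f′ E)
  ·ˢ-congˡ {suc n} g f≈f′ E = ΣᴷupTo-cong (suc (E Fin.zero)) (λ a _ → ·ˢ-congˡ _ (λ e → f≈f′ (a ∷ e)) (tail E))

  ·ˢ-congʳ : ∀ {n} (f : Ser n) {g g′ : Ser n} → g ≈ˢ g′ → (f ·ˢ g) ≈ˢ (f ·ˢ g′)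
  ·ˢ-congʳ {zero}  f g≈g′ E = *-congˡ (g≈g′ E)
  ·ˢ-congʳ {suc n} f g≈g′ E = ΣᴷupTo-cong (suc (E Fin.zero)) (λ a _ → ·ˢ-congʳ _ (λ e → g≈g′ ((E Fin.zero ∸ a) ∷ e)) (tail E))

  ·ˢ-zeroˡ : ∀ {n} {f : Ser n} (g : Ser n) → f ≈ˢ zeroˢ → (f ·ˢ g) ≈ˢ zeroˢ
  ·ˢ-zeroˡ {zero}  g f≈0 E = trans (*-congʳ (f≈0 E)) (zeroˡ _)
  ·ˢ-zeroˡ {suc n} g f≈0 E = ΣᴷupTo-zero (suc (E Fin.zero)) _ (λ a _ → ·ˢ-zeroˡ _ (λ e → f≈0 (a ∷ e)) (tail E))

  ·ˢ-zeroʳ : ∀ {n} (f : Ser n) {g : Ser n} → g ≈ˢ zeroˢ → (f ·ˢ g) ≈ˢ zeroˢ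
  ·ˢ-zeroʳ {zero}  f g≈0 E = trans (*-congˡ (g≈0 E)) (zeroʳ _)
  ·ˢ-zeroʳ {suc n} f g≈0 E = ΣᴷupTo-zero (suc (E Fin.zero)) _ (λ a _ → ·ˢ-zeroʳ _ (λ e → g≈0 ((E Fin.zero ∸ a) ∷ e)) (tail E))

  ·ˢ-distribˡ : ∀ {n} (f g h : Ser n) E → (f ·ˢ (λ e → g e + h e)) E ≈ (f ·ˢ g) E + (f ·ˢ h) E
  ·ˢ-distribˡ {zero}  f g h E = distribˡ _ _ _
  ·ˢ-distribˡ {suc n} f g h E = trans
    (ΣᴷupTo-cong (suc E0) (λ a _ → ·ˢ-distribˡ (λ e → f (a ∷ e)) (λ e → g ((E0 ∸ a) ∷ e)) (λ e → h ((E0 ∸ a) ∷ e)) (tail E)))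
    (ΣᴷupTo-+ (suc E0) _ _)
    where E0 = E Fin.zero

  ·ˢ-*ˡ : ∀ {n} x (f g : Ser n) E → ((λ e → x * f e) ·ˢ g) E ≈ x * (f ·ˢ g) E
  ·ˢ-*ˡ {zero}  x f g E = *-assoc _ _ _
  ·ˢ-*ˡ {suc n} x f g E = trans
    (ΣᴷupTo-cong (suc E0) (λ a _ → ·ˢ-*ˡ x (λ e → f (a ∷ e)) (λ e → g ((E0 ∸ a) ∷ e)) (tail E)))
    (ΣᴷupTo-*ˡ (suc E0) x _)
    where E0 = E Fin.zero

  ·ˢ-*ʳ : ∀ {n} x (f g : Ser n) E → (f ·ˢ (λ e → x * g e)) E ≈ x * (f ·ˢ g) E
  ·ˢ-*ʳ {zero}  x f g E = trans (sym (*-assoc _ _ _)) (trans (*-congʳ (*-comm _ _)) (*-assoc _ _ _))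
  ·ˢ-*ʳ {suc n} x f g E = trans
    (ΣᴷupTo-cong (suc E0) (λ a _ → ·ˢ-*ʳ x (λ e → f (a ∷ e)) (λ e → g ((E0 ∸ a) ∷ e)) (tail E)))
    (ΣᴷupTo-*ˡ (suc E0) x _)
    where E0 = E Fin.zero

  mono-∷ : ∀ {n} (e : Fin (suc n) → ℕ) b (e′ : Fin n → ℕ) → mono e (b ∷ e′) ≈ [ b ≡ᵇ e Fin.zero ] * mono (tail e) e′
  mono-∷ e b e′ = trans (reflexive (≡.cong [_] (allᵇ-suc (λ v → (b ∷ e′) v ≡ᵇ e v)))) ([]-∧ (b ≡ᵇ e Fin.zero) _)

  mono-extensional : ∀ {n} (e : Fin n → ℕ) → Extensional (mono e)
  mono-extensional e E≗E′ = reflexive (≡.cong [_] (allᵇ-cong (λ v → ≡.cong (_≡ᵇ e v) (E≗E′ v))))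

  shifted-∷ : ∀ {n} (f : Ser (suc n)) → Extensional f → ∀ e E →
    [ e ≤ᵉ E ] * f (E ∸ᵉ e) ≈
    [ e Fin.zero ≤ᵇ E Fin.zero ] * ([ tail e ≤ᵉ tail E ] * f ((E Fin.zero ∸ e Fin.zero) ∷ (tail E ∸ᵉ tail e)))
  shifted-∷ f ext e E rewrite ≤ᵉ-suc e E = trans
    (*-cong ([]-∧ (e Fin.zero ≤ᵇ E Fin.zero) _) (ext λ { Fin.zero → ≡.refl ; (Fin.suc v) → ≡.refl }))
    (*-assoc _ _ _)

  ·ˢ-monoʳ : ∀ {n} (f : Ser n) e → Extensional f → ∀ E → (f ·ˢ mono e) E ≈ [ e ≤ᵉ E ] * f (E ∸ᵉ e)
  ·ˢ-monoʳ {zero}  f e ext E = trans (*-identityʳ _) (trans (ext (λ ())) (sym (*-identityˡ _)))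
  ·ˢ-monoʳ {suc n} f e ext E = begin
    ΣᴷupTo (suc E0) (λ a → ((λ x → f (a ∷ x)) ·ˢ (λ x → mono e ((E0 ∸ a) ∷ x))) (tail E))
      ≈⟨ ΣᴷupTo-cong (suc E0) (λ a _ → term a) ⟩
    ΣᴷupTo (suc E0) (λ a → [ (E0 ∸ a) ≡ᵇ e0 ] * ([ tail e ≤ᵉ tail E ] * f (a ∷ (tail E ∸ᵉ tail e))))
      ≈⟨ ΣᴷupTo-indicator E0 e0 _ _ (E0 ∸ e0)
           (λ e0≤E0 → ℕ.m∸n≤m E0 e0 , ≡⇒≡ᵇ _ _ (ℕ.m∸[m∸n]≡n e0≤E0))
           (λ a a≤E0 hit → let E0∸a≡e0 = ≡ᵇ⇒≡ _ _ hit in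
              ≡.subst (_≤ E0) E0∸a≡e0 (ℕ.m∸n≤m E0 a) , ≡.trans (≡.sym (ℕ.m∸[m∸n]≡n a≤E0)) (≡.cong (E0 ∸_) E0∸a≡e0)) ⟩
    [ e0 ≤ᵇ E0 ] * ([ tail e ≤ᵉ tail E ] * f ((E0 ∸ e0) ∷ (tail E ∸ᵉ tail e)))
      ≈⟨ shifted-∷ f ext e E ⟨
    [ e ≤ᵉ E ] * f (E ∸ᵉ e) ∎
    where
    E0 = E Fin.zero
    e0 = e Fin.zero
    term : ∀ a → ((λ x → f (a ∷ x)) ·ˢ (λ x → mono e ((E0 ∸ a) ∷ x))) (tail E)
               ≈ [ (E0 ∸ a) ≡ᵇ e0 ] * ([ tail e ≤ᵉ tail E ] * f (a ∷ (tail E ∸ᵉ tail e)))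
    term a = trans (·ˢ-congʳ (λ x → f (a ∷ x)) (mono-∷ e (E0 ∸ a)) (tail E))
            (trans (·ˢ-*ʳ _ (λ x → f (a ∷ x)) (mono (tail e)) (tail E))
                   (*-congˡ (·ˢ-monoʳ (λ x → f (a ∷ x)) (tail e) (extensional-∷ a ext) (tail E))))

  ·ˢ-monoˡ : ∀ {n} e (g : Ser n) → Extensional g → ∀ E → (mono e ·ˢ g) E ≈ [ e ≤ᵉ E ] * g (E ∸ᵉ e)
  ·ˢ-monoˡ {zero}  e g ext E = *-congˡ (ext (λ ()))
  ·ˢ-monoˡ {suc n} e g ext E = begin
    ΣᴷupTo (suc E0) (λ a → ((λ x → mono e (a ∷ x)) ·ˢ (λ x → g ((E0 ∸ a) ∷ x))) (tail E))
      ≈⟨ ΣᴷupTo-cong (suc E0) (λ a _ → term a) ⟩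
    ΣᴷupTo (suc E0) (λ a → [ a ≡ᵇ e0 ] * ([ tail e ≤ᵉ tail E ] * g ((E0 ∸ a) ∷ (tail E ∸ᵉ tail e))))
      ≈⟨ ΣᴷupTo-indicator E0 e0 _ _ e0 (λ e0≤E0 → e0≤E0 , ≡⇒≡ᵇ e0 e0 ≡.refl)
           (λ a a≤E0 hit → let a≡e0 = ≡ᵇ⇒≡ _ _ hit in ≡.subst (_≤ E0) a≡e0 a≤E0 , a≡e0) ⟩
    [ e0 ≤ᵇ E0 ] * ([ tail e ≤ᵉ tail E ] * g ((E0 ∸ e0) ∷ (tail E ∸ᵉ tail e)))
      ≈⟨ shifted-∷ g ext e E ⟨
    [ e ≤ᵉ E ] * g (E ∸ᵉ e) ∎
    where
    E0 = E Fin.zero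
    e0 = e Fin.zero
    term : ∀ a → ((λ x → mono e (a ∷ x)) ·ˢ (λ x → g ((E0 ∸ a) ∷ x))) (tail E)
               ≈ [ a ≡ᵇ e0 ] * ([ tail e ≤ᵉ tail E ] * g ((E0 ∸ a) ∷ (tail E ∸ᵉ tail e)))
    term a = trans (·ˢ-congˡ (λ x → g ((E0 ∸ a) ∷ x)) (mono-∷ e a) (tail E))
            (trans (·ˢ-*ˡ _ (mono (tail e)) (λ x → g ((E0 ∸ a) ∷ x)) (tail E))
                   (*-congˡ (·ˢ-monoˡ (tail e) (λ x → g ((E0 ∸ a) ∷ x)) (extensional-∷ (E0 ∸ a) ext) (tail E))))

  -- Polynomials as explicit lists of terms a x^e: multiplying by them termwise avoids proving ·ˢ associative.

  Poly : ℕ → Set c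
  Poly n = List (Carrier × (Fin n → ℕ))

  poly : ∀ {n} → Poly n → Ser n
  poly []               E = 0#
  poly ((a , e) ∷ₗ L) E = a * mono e E + poly L E

  act : ∀ {n} → Poly n → Ser n → Ser n
  act []               f E = 0#
  act ((a , e) ∷ₗ L) f E = a * ([ e ≤ᵉ E ] * f (E ∸ᵉ e)) + act L f E

  negShift : ∀ {n} → (Fin n → ℕ) → Carrier × (Fin n → ℕ) → Carrier × (Fin n → ℕ)
  negShift χ (a , e) = - a , e +ᵉ χ

  ·ˢ-poly : ∀ {n} (f : Ser n) → Extensional f → ∀ L E → (f ·ˢ poly L) E ≈ act L f E
  ·ˢ-poly f ext []               E = ·ˢ-zeroʳ f (λ _ → refl) E
  ·ˢ-poly f ext ((a , e) ∷ₗ L) E = trans (·ˢ-distribˡ f (λ E → a * mono e E) (poly L) E)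
    (+-cong (trans (·ˢ-*ʳ a f (mono e) E) (*-congˡ (·ˢ-monoʳ f e ext E))) (·ˢ-poly f ext L E))

  poly-extensional : ∀ {n} (L : Poly n) → Extensional (poly L)
  poly-extensional []               E≗E′ = refl
  poly-extensional ((a , e) ∷ₗ L) E≗E′ = +-cong (*-congˡ (mono-extensional e E≗E′)) (poly-extensional L E≗E′)

  mono-+ᵉ : ∀ {n} (e χ E : Fin n → ℕ) → mono (e +ᵉ χ) E ≈ [ χ ≤ᵉ E ] * mono e (E ∸ᵉ χ)
  mono-+ᵉ e χ E = trans (reflexive (≡.cong [_] (≡.trans (allᵇ-cong (λ v → ≡ᵇ-+ (E v) (e v) (χ v)))
                                                           (allᵇ-∧ (λ v → χ v ≤ᵇ E v) (λ v → E v ∸ χ v ≡ᵇ e v)))))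
                        ([]-∧ (χ ≤ᵉ E) _)

  poly-++ : ∀ {n} (L L′ : Poly n) E → poly (L ++ L′) E ≈ poly L E + poly L′ E
  poly-++ []               L′ E = sym (+-identityˡ _)
  poly-++ ((a , e) ∷ₗ L) L′ E = trans (+-congˡ (poly-++ L L′ E)) (sym (+-assoc _ _ _))

  act-++ : ∀ {n} (L L′ : Poly n) f E → act (L ++ L′) f E ≈ act L f E + act L′ f E
  act-++ []               L′ f E = sym (+-identityˡ _)
  act-++ ((a , e) ∷ₗ L) L′ f E = trans (+-congˡ (act-++ L L′ f E)) (sym (+-assoc _ _ _))

  -*0≈0 : ∀ b → - (b * 0#) ≈ 0#
  -*0≈0 b = trans (-‿cong (zeroʳ b)) -0#≈0#

  -a*bm+-br≈-b[am+r] : ∀ a b m r → (- a) * (b * m) + - (b * r) ≈ - (b * (a * m + r))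
  -a*bm+-br≈-b[am+r] a b m r = begin
    (- a) * (b * m) + - (b * r)  ≈⟨ +-congʳ (sym (-‿distribˡ-* a (b * m))) ⟩
    - (a * (b * m)) + - (b * r)  ≈⟨ +-congʳ (-‿cong (x∙yz≈y∙xz a b m)) ⟩
    - (b * (a * m)) + - (b * r)  ≈⟨ ⁻¹-∙-comm _ _ ⟩
    - (b * (a * m) + b * r)      ≈⟨ -‿cong (distribˡ b (a * m) r) ⟨
    - (b * (a * m + r))          ∎

  poly-negShift : ∀ {n} χ (L : Poly n) E → poly (map (negShift χ) L) E ≈ - ([ χ ≤ᵉ E ] * poly L (E ∸ᵉ χ))
  poly-negShift χ []               E = sym (-*0≈0 _)
  poly-negShift χ ((a , e) ∷ₗ L) E =
    trans (+-cong (*-congˡ (mono-+ᵉ e χ E)) (poly-negShift χ L E)) (-a*bm+-br≈-b[am+r] a _ _ _)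

  act-negShift : ∀ {n} χ (L : Poly n) f → Extensional f → ∀ E →
    act (map (negShift χ) L) f E ≈ - ([ χ ≤ᵉ E ] * act L f (E ∸ᵉ χ))
  act-negShift χ []               f ext E = sym (-*0≈0 _)
  act-negShift χ ((a , e) ∷ₗ L) f ext E =
    trans (+-cong (*-congˡ shift-twice) (act-negShift χ L f ext E)) (-a*bm+-br≈-b[am+r] a _ _ _)
    where
    shift-twice : [ (e +ᵉ χ) ≤ᵉ E ] * f (E ∸ᵉ (e +ᵉ χ)) ≈ [ χ ≤ᵉ E ] * ([ e ≤ᵉ (E ∸ᵉ χ) ] * f ((E ∸ᵉ χ) ∸ᵉ e))
    shift-twice = trans (*-cong (trans (reflexive (≡.cong [_] (+ᵉ-≤ᵉ e χ E))) ([]-∧ (χ ≤ᵉ E) _))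
                                (ext (λ v → ≡.trans (≡.cong (E v ∸_) (ℕ.+-comm (e v) (χ v))) (≡.sym (ℕ.∸-+-assoc (E v) (χ v) (e v))))))
                        (*-assoc _ _ _)

  shift-0ᵉ : ∀ {n} (f : Ser n) → Extensional f → ∀ E → [ 0ᵉ ≤ᵉ E ] * f (E ∸ᵉ 0ᵉ) ≈ f E
  shift-0ᵉ f ext E = trans ([]*-true _ (0ᵉ≤ᵉ E)) (ext (λ _ → ≡.refl))

  ·ˢ-oneʳ : ∀ {n} (f : Ser n) → Extensional f → ∀ E → (f ·ˢ oneˢ) E ≈ f E
  ·ˢ-oneʳ f ext E = trans (·ˢ-monoʳ f 0ᵉ ext E) (shift-0ᵉ f ext E)

module QuotientFormula {c ℓ} (K : CommutativeRing c ℓ) where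

  open import Data.Bool using (true; false; if_then_else_; _∧_; T; T?)
  open import Data.Empty using (⊥; ⊥-elim)
  open import Data.Fin as Fin using (toℕ; fromℕ<)
  open import Data.Fin.Properties using (toℕ<n; toℕ-fromℕ<)
  open import Data.List using ([]; _++_; map) renaming (_∷_ to _∷ₗ_)
  open import Data.Nat as ℕ using (zero; suc; _∸_; _<_; _<ᵇ_; _≤ᵇ_; _≡ᵇ_; s≤s; s≤s⁻¹)
  open import Data.Nat.Properties as ℕ using (≡ᵇ⇒≡; ≡⇒≡ᵇ; ≤ᵇ⇒≤; ≤⇒≤ᵇ; <ᵇ⇒<; <⇒<ᵇ)
  open import Data.Product using (proj₁)
  open import Data.Sum using (inj₁; inj₂)
  open import Function using (_∘_)
  import Relation.Binary.PropositionalEquality as ≡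
  open import Relation.Nullary using (¬_; yes; no)
  open import Relation.Nullary.Decidable using (decidable-stable)

  open Combinatorics
  open PowerSeries K
  open CommutativeRing K
  open Over K
  open import Relation.Binary.Reasoning.Setoid setoid
  open import Algebra.Properties.Ring ring using (-1*x≈-x; -0#≈0#)

  Θ : Alg
  Θ n w E = [ chainAlongᵇ w E ]

  Θ-extensional : ∀ n w → Extensional (Θ n w)
  Θ-extensional n w {E} {E′} E≗E′ = reflexive (≡.cong [_] (tightAlongᵇ-cong 0 w {E} {E′} (E≗E′ ∘ w)))

  denPoly : ∀ {n} → (Fin n → Fin n) → ℕ → Poly n
  denPoly w zero    = (1# , 0ᵉ) ∷ₗ []
  denPoly w (suc i) = denPoly w i ++ map (negShift (prefixExp w (suc i))) (denPoly w i)

  act-unit : ∀ {n} (f : Ser n) → Extensional f → ∀ E → act ((1# , 0ᵉ) ∷ₗ []) f E ≈ f E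
  act-unit f ext E = trans (+-identityʳ _) (trans (*-identityˡ _) (shift-0ᵉ f ext E))

  prefixProducts≈denPoly : ∀ {n} (w : Fin n → Fin n) i → ∏ˢ i (λ j → oneˢ -ˢ P w (suc j)) ≈ˢ poly (denPoly w i)
  prefixProducts≈denPoly w zero    E = sym (trans (+-identityʳ _) (*-identityˡ _))
  prefixProducts≈denPoly w (suc i) E = begin
    (∏ˢ i (λ j → oneˢ -ˢ P w (suc j)) ·ˢ (oneˢ -ˢ mono χ)) E
      ≈⟨ ·ˢ-congˡ _ (prefixProducts≈denPoly w i) E ⟩
    (poly L ·ˢ (oneˢ -ˢ mono χ)) E
      ≈⟨ ·ˢ-congʳ (poly L) (λ E′ → +-congˡ (sym (-1*x≈-x _))) E ⟩
    (poly L ·ˢ (λ E′ → oneˢ E′ + (- 1#) * mono χ E′)) E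
      ≈⟨ ·ˢ-distribˡ (poly L) oneˢ (λ E′ → (- 1#) * mono χ E′) E ⟩
    (poly L ·ˢ oneˢ) E + (poly L ·ˢ (λ E′ → (- 1#) * mono χ E′)) E
      ≈⟨ +-cong (·ˢ-oneʳ (poly L) (poly-extensional L) E) (trans (·ˢ-*ʳ (- 1#) (poly L) (mono χ) E) (-1*x≈-x _)) ⟩
    poly L E + - (poly L ·ˢ mono χ) E
      ≈⟨ +-congˡ (-‿cong (·ˢ-monoʳ (poly L) χ (poly-extensional L) E)) ⟩
    poly L E + - ([ χ ≤ᵉ E ] * poly L (E ∸ᵉ χ))
      ≈⟨ +-congˡ (poly-negShift χ L E) ⟨
    poly L E + poly (map (negShift χ) L) E
      ≈⟨ poly-++ L _ E ⟨
    poly (denPoly w (suc i)) E ∎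
    where
    L = denPoly w i
    χ = prefixExp w (suc i)

  act-denPoly-suc : ∀ {n} (w : Fin n → Fin n) i f → Extensional f → ∀ E →
    act (denPoly w (suc i)) f E ≈
    act (denPoly w i) f E + - ([ prefixExp w (suc i) ≤ᵉ E ] * act (denPoly w i) f (E ∸ᵉ prefixExp w (suc i)))
  act-denPoly-suc w i f ext E = trans (act-++ (denPoly w i) _ f E) (+-congˡ (act-negShift (prefixExp w (suc i)) (denPoly w i) f ext E))

  indicator-difference : ∀ a b c d → (T d → T a) → (T d → T b → T c → ⊥) → (T a → ¬ T d → T b × T c) → (T b → T c → T a) →
    [ a ] + - ([ b ] * [ c ]) ≈ [ d ]
  indicator-difference a b c d d⇒a d⇒¬bc a¬d⇒bc bc⇒a with T? (b ∧ c)
  ... | yes tbc = let tb , tc = T-∧⁻ {b} tbc in both tb tc (bc⇒a tb tc) (λ td → d⇒¬bc td tb tc)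
    where
    both : T b → T c → T a → ¬ T d → [ a ] + - ([ b ] * [ c ]) ≈ [ d ]
    both tb tc ta ¬td rewrite []-true tb | []-true tc | []-true ta | []-false ¬td =
      trans (+-congˡ (-‿cong (*-identityˡ 1#))) (-‿inverseʳ 1#)
  ... | no ¬tbc = trans (+-congˡ (trans (-‿cong (trans (sym ([]-∧ b c)) (reflexive ([]-false ¬tbc)))) -0#≈0#))
                        (trans (+-identityʳ _) ([]-cong a⇒d d⇒a))
    where
    a⇒d : T a → T d
    a⇒d ta = decidable-stable (T? d) (λ ¬td → let tb , tc = a¬d⇒bc ta ¬td in ¬tbc (T-∧⁺ tb tc))

  module DenominatorStep {n} (σ : Fin n → Fin n) (inj : Injective _≡_ _≡_ σ) (i : ℕ) (i<n : i < n) (E : Fin n → ℕ) where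

    χ = prefixExp σ (suc i)
    V = weight σ E
    V′ = weight σ (E ∸ᵉ χ)
    δ = descent n (letter σ)

    V′-at : ∀ p → V′ p ≡ V p ∸ [ p <ᵇ suc i ]ℕ
    V′-at = at-map (E ∘ σ) (λ q → E (σ q) ∸ χ (σ q)) (λ p x → x ∸ [ p <ᵇ suc i ]ℕ)
                   (λ q → ≡.cong (E (σ q) ∸_) (prefixExp-at σ inj (suc i) q)) (λ p → ℕ.0∸n≡0 [ p <ᵇ suc i ]ℕ)

    lowered : ∀ p → p ≤ i → V′ p ≡ V p ∸ 1
    lowered p p≤i = ≡.trans (V′-at p) (≡.cong (λ b → V p ∸ [ b ]ℕ) (T⇒≡true (<⇒<ᵇ (s≤s p≤i))))

    kept : ∀ p → i < p → V′ p ≡ V p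
    kept p i<p = ≡.trans (V′-at p) (≡.cong (λ b → V p ∸ [ b ]ℕ) (¬T⇒≡false (λ p<1+i → ℕ.<⇒≱ (<ᵇ⇒< p (suc i) p<1+i) i<p)))

    open LowerPrefix n δ i i<n V V′ lowered kept

    ≤ᵉ⇒positive : T (χ ≤ᵉ E) → Positive
    ≤ᵉ⇒positive χ≤E p p≤i =
      ≡.subst (1 ≤_) (≡.sym (at-< (E ∘ σ) p p<n)) (≡.subst (_≤ E (σ q)) χ[σq]≡1 (≤ᵇ⇒≤ _ _ (allᵇ⁻ _ χ≤E (σ q))))
      where
      p<n = ℕ.≤-<-trans p≤i i<n
      q = fromℕ< p<n
      χ[σq]≡1 : χ (σ q) ≡ 1
      χ[σq]≡1 = ≡.trans (prefixExp-at σ inj (suc i) q)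
                  (≡.cong [_]ℕ (T⇒≡true (<⇒<ᵇ (s≤s (≡.subst (_≤ i) (≡.sym (toℕ-fromℕ< p<n)) p≤i)))))

    positive⇒≤ᵉ : Positive → T (χ ≤ᵉ E)
    positive⇒≤ᵉ positive = allᵇ⁺ (λ v → χ v ≤ᵇ E v) (λ v → at-image v (injective⇒surjective σ inj v))
      where
      at-image : ∀ v → (∃ λ q → σ q ≡ v) → T (χ v ≤ᵇ E v)
      at-image .(σ q) (q , ≡.refl) rewrite prefixExp-at σ inj (suc i) q with toℕ q <ᵇ suc i in q<1+i
      ... | true  = ≤⇒≤ᵇ (≡.subst (1 ≤_) (at-toℕ (E ∘ σ) q) (positive (toℕ q) (s≤s⁻¹ (<ᵇ⇒< _ _ (≡true⇒T q<1+i)))))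
      ... | false = _

    tightAlong⁻ : ∀ j E′ → T (tightAlongᵇ j σ E′) → TightBelow n δ j (weight σ E′)
    tightAlong⁻ j E′ = tightᵇ⁻ n δ j (weight σ E′)

    tightAlong⁺ : ∀ j E′ → TightBelow n δ j (weight σ E′) → T (tightAlongᵇ j σ E′)
    tightAlong⁺ j E′ = tightᵇ⁺ n δ j (weight σ E′)

    step : [ tightAlongᵇ i σ E ] + - ([ χ ≤ᵉ E ] * [ tightAlongᵇ i σ (E ∸ᵉ χ) ]) ≈ [ tightAlongᵇ (suc i) σ E ]
    step = indicator-difference _ _ _ _
      (λ d → tightAlong⁺ i E (tightBelow-suc⁻ (tightAlong⁻ (suc i) E d)))
      (λ d χ≤E t′ → tightBelow-suc⇒¬lowered (tightAlong⁻ (suc i) E d) (≤ᵉ⇒positive χ≤E) (tightAlong⁻ i (E ∸ᵉ χ) t′))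
      slack
      (λ χ≤E t′ → tightAlong⁺ i E (lowered⇒tightBelow (≤ᵉ⇒positive χ≤E) (tightAlong⁻ i (E ∸ᵉ χ) t′)))
      where
      slack : T (tightAlongᵇ i σ E) → ¬ T (tightAlongᵇ (suc i) σ E) → T (χ ≤ᵉ E) × T (tightAlongᵇ i σ (E ∸ᵉ χ))
      slack t ¬t+1 with V (suc i) ℕ.+ δ i ℕ.≟ V i
      ... | yes tight-at-i = ⊥-elim (¬t+1 (tightAlong⁺ (suc i) E (tightBelow-suc⁺ (tightAlong⁻ i E t) tight-at-i)))
      ... | no  slack-at-i = let positive , t′ = tightBelow⇒lowered (tightAlong⁻ i E t) slack-at-i
                             in positive⇒≤ᵉ positive , tightAlong⁺ i (E ∸ᵉ χ) t′

  act-denPoly : ∀ n (σ : Fin n → Fin n) → Injective _≡_ _≡_ σ → ∀ i → i ≤ n → ∀ E →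
    act (denPoly σ i) (Θ n σ) E ≈ [ tightAlongᵇ i σ E ]
  act-denPoly n σ inj zero    _   E = act-unit (Θ n σ) (Θ-extensional n σ) E
  act-denPoly n σ inj (suc i) i<n E = begin
    act (denPoly σ (suc i)) (Θ n σ) E
      ≈⟨ act-denPoly-suc σ i (Θ n σ) (Θ-extensional n σ) E ⟩
    act (denPoly σ i) (Θ n σ) E + - ([ χ ≤ᵉ E ] * act (denPoly σ i) (Θ n σ) (E ∸ᵉ χ))
      ≈⟨ +-cong (act-denPoly n σ inj i i≤n E) (-‿cong (*-congˡ (act-denPoly n σ inj i i≤n (E ∸ᵉ χ)))) ⟩
    [ tightAlongᵇ i σ E ] + - ([ χ ≤ᵉ E ] * [ tightAlongᵇ i σ (E ∸ᵉ χ) ])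
      ≈⟨ DenominatorStep.step σ inj i i<n E ⟩
    [ tightAlongᵇ (suc i) σ E ] ∎
    where
    χ = prefixExp σ (suc i)
    i≤n = ℕ.<⇒≤ i<n

  numExp : ∀ {n} → (Fin n → Fin n) → ℕ → Fin n → ℕ
  numExp w zero    = 0ᵉ
  numExp w (suc j) = numExp w j +ᵉ (if inDᵇ w j then prefixExp w j else 0ᵉ)

  descentProducts≈mono : ∀ {n} (w : Fin n → Fin n) j → ∏ˢ j (λ j′ → if inDᵇ w j′ then P w j′ else oneˢ) ≈ˢ mono (numExp w j)
  descentProducts≈mono w zero    E = refl
  descentProducts≈mono w (suc j) E = begin
    (∏ˢ j factor ·ˢ factor j) E             ≈⟨ ·ˢ-congˡ (factor j) (descentProducts≈mono w j) E ⟩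
    (mono (numExp w j) ·ˢ factor j) E       ≈⟨ ·ˢ-congʳ (mono (numExp w j)) (factor≈mono (inDᵇ w j)) E ⟩
    (mono (numExp w j) ·ˢ mono χ) E         ≈⟨ ·ˢ-monoʳ (mono (numExp w j)) χ (mono-extensional (numExp w j)) E ⟩
    [ χ ≤ᵉ E ] * mono (numExp w j) (E ∸ᵉ χ) ≈⟨ mono-+ᵉ (numExp w j) χ E ⟨
    mono (numExp w (suc j)) E               ∎
    where
    factor = λ j′ → if inDᵇ w j′ then P w j′ else oneˢ
    χ = if inDᵇ w j then prefixExp w j else 0ᵉ
    factor≈mono : ∀ b → (if b then P w j else oneˢ) ≈ˢ mono (if b then prefixExp w j else 0ᵉ)
    factor≈mono true  E = refl
    factor≈mono false E = refl

  numExp-at : ∀ {n} (w : Fin n → Fin n) → Injective _≡_ _≡_ w → ∀ j q → numExp w j (w q) ≡ descentsAbove j (inDᵇ w) (toℕ q)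
  numExp-at w inj zero    q = ≡.refl
  numExp-at w inj (suc j) q = ≡.cong₂ ℕ._+_ (numExp-at w inj j q) (last (inDᵇ w j))
    where
    last : ∀ b → (if b then prefixExp w j else 0ᵉ) (w q) ≡ (if b then [ toℕ q <ᵇ j ]ℕ else 0)
    last true  = prefixExp-at w inj j q
    last false = ≡.refl

  inDᵇ-at : ∀ {n} (w : Fin n → Fin n) p → suc p < n → inDᵇ w (suc p) ≡ (letter w (suc p) <ᵇ letter w p)
  inDᵇ-at {n} w p 1+p<n = T-ext found witness
    where
    p<n = ℕ.<-trans (ℕ.n<1+n p) 1+p<n
    found : T (inDᵇ w (suc p)) → T (letter w (suc p) <ᵇ letter w p)
    found h =
      let k , h′ = anyᵇ⁻ _ h
          k′ , h″ = anyᵇ⁻ _ h′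
          k≡p , rest = T-∧⁻ {toℕ k ≡ᵇ p} h″
          k′≡1+p , w[k′]<w[k] = T-∧⁻ {toℕ k′ ≡ᵇ suc p} rest
          letter-at : ∀ q (i : Fin n) → T (toℕ i ≡ᵇ q) → toℕ (w i) ≡ letter w q
          letter-at q i i≡q = ≡.trans (≡.sym (at-toℕ (toℕ ∘ w) i)) (≡.cong (letter w) (≡ᵇ⇒≡ _ _ i≡q))
      in ≡.subst₂ (λ a b → T (a <ᵇ b)) (letter-at (suc p) k′ k′≡1+p) (letter-at p k k≡p) w[k′]<w[k]
    witness : T (letter w (suc p) <ᵇ letter w p) → T (inDᵇ w (suc p))
    witness lt = anyᵇ⁺ _ (fromℕ< p<n) (anyᵇ⁺ _ (fromℕ< 1+p<n)
      (T-∧⁺ (≡⇒≡ᵇ _ _ (toℕ-fromℕ< p<n)) (T-∧⁺ (≡⇒≡ᵇ _ _ (toℕ-fromℕ< 1+p<n))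
        (≡.subst₂ (λ a b → T (a <ᵇ b)) (at-< (toℕ ∘ w) (suc p) 1+p<n) (at-< (toℕ ∘ w) p p<n) lt))))

  inDᵇ-descent : ∀ {n} (w : Fin n → Fin n) p → [ inDᵇ w (suc p) ∧ (suc p <ᵇ n) ]ℕ ≡ descent n (letter w) p
  inDᵇ-descent {n} w p = ≡.cong [_]ℕ (guarded-∧-comm (λ 1+p<n → inDᵇ-at w p (<ᵇ⇒< (suc p) n 1+p<n)))

  fullyTight≡numExp : ∀ n (σ : Fin n → Fin n) → Injective _≡_ _≡_ σ → ∀ E → tightAlongᵇ n σ E ≡ eqExpᵇ E (numExp σ n)
  fullyTight≡numExp n σ inj E = T-ext fully-tight⇒ ⇒fully-tight
    where
    V = weight σ E
    δ = descent n (letter σ)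
    G = descentsAbove n (inDᵇ σ)
    G-step : ∀ p → p < n → G (suc p) ℕ.+ δ p ≡ G p
    G-step p _ = ≡.sym (≡.trans (descentsAbove-step n (inDᵇ σ) p) (≡.cong (G (suc p) ℕ.+_) (inDᵇ-descent σ p)))
    V-end≡G-end : V n ≡ G n
    V-end≡G-end = ≡.trans (at-≥ (E ∘ σ) n ℕ.≤-refl) (≡.sym (descentsAbove-≥ n (inDᵇ σ) n (ℕ.n≤1+n n)))
    fully-tight⇒ : T (tightAlongᵇ n σ E) → T (eqExpᵇ E (numExp σ n))
    fully-tight⇒ h = allᵇ⁺ _ (λ v → at-image v (injective⇒surjective σ inj v))
      where
      tight = tightᵇ⁻ n δ n V h
      V≡G = backward-unique n δ V G (λ p p<n → proj₁ (tight p p<n) p<n) G-step V-end≡G-end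
      at-image : ∀ v → (∃ λ q → σ q ≡ v) → T (E v ≡ᵇ numExp σ n v)
      at-image .(σ q) (q , ≡.refl) = ≡⇒≡ᵇ _ _ (≡.trans (≡.sym (at-toℕ (E ∘ σ) q))
        (≡.trans (V≡G (toℕ q) (ℕ.<⇒≤ (toℕ<n q))) (≡.sym (numExp-at σ inj n q))))
    ⇒fully-tight : T (eqExpᵇ E (numExp σ n)) → T (tightAlongᵇ n σ E)
    ⇒fully-tight h = tightᵇ⁺ n δ n V (λ p p<n → (λ _ → tight p p<n) , (λ n≤p → ⊥-elim (ℕ.<⇒≱ p<n n≤p)))
      where
      V≡G : ∀ p → p ≤ n → V p ≡ G p
      V≡G p p≤n with ℕ.m≤n⇒m<n∨m≡n p≤n
      ... | inj₂ ≡.refl = V-end≡G-end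
      ... | inj₁ p<n = ≡.trans (at-< (E ∘ σ) p p<n) (≡.trans (≡ᵇ⇒≡ _ _ (allᵇ⁻ _ h (σ (fromℕ< p<n))))
                         (≡.trans (numExp-at σ inj n (fromℕ< p<n)) (≡.cong G (toℕ-fromℕ< p<n))))
      tight : ∀ p → p < n → V (suc p) ℕ.+ δ p ≡ V p
      tight p p<n = ≡.trans (≡.cong (ℕ._+ δ p) (V≡G (suc p) p<n)) (≡.trans (G-step p p<n) (≡.sym (V≡G p (ℕ.<⇒≤ p<n))))

  Θ·den≈num : ∀ n (σ : Fin n → Fin n) → Injective _≡_ _≡_ σ → (Θ n σ ·ˢ ΘDen σ) ≈ˢ ΘNum σ
  Θ·den≈num n σ inj E = begin
    (Θ n σ ·ˢ ΘDen σ) E               ≈⟨ ·ˢ-congʳ (Θ n σ) (prefixProducts≈denPoly σ n) E ⟩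
    (Θ n σ ·ˢ poly (denPoly σ n)) E   ≈⟨ ·ˢ-poly (Θ n σ) (Θ-extensional n σ) (denPoly σ n) E ⟩
    act (denPoly σ n) (Θ n σ) E       ≈⟨ act-denPoly n σ inj n ℕ.≤-refl E ⟩
    [ tightAlongᵇ n σ E ]             ≡⟨ ≡.cong [_] (fullyTight≡numExp n σ inj E) ⟩
    mono (numExp σ n) E               ≈⟨ descentProducts≈mono σ n E ⟨
    ΘNum σ E                          ∎

module ProductFormula {c ℓ} (K : CommutativeRing c ℓ) where

  open import Data.Bool using (Bool; true; false; if_then_else_; _∧_; T; T?)
  open import Data.Bool.Properties using (∧-identityʳ)
  open import Data.Fin as Fin using (toℕ; fromℕ<; inject≤; cast; _↑ʳ_)
  open import Data.Fin.Properties using (toℕ-injective; toℕ<n; toℕ-fromℕ<; toℕ≤pred[n]; toℕ-inject≤; toℕ-cast; toℕ-↑ʳ)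
  open import Data.Nat as ℕ using (zero; suc; _∸_; _<_; _<ᵇ_; _≡ᵇ_; z≤n; s≤s; _<?_)
  open import Data.Nat.Properties as ℕ using (≡ᵇ⇒≡; ≡⇒≡ᵇ)
  open import Data.Product using (proj₁; proj₂)
  open import Data.Sum using (_⊎_; inj₁; inj₂)
  open import Function using (_∘_)
  import Relation.Binary.PropositionalEquality as ≡
  open ≡ using (_≢_)
  open import Relation.Nullary using (¬_; yes; no)

  open Combinatorics
  open PowerSeries K
  open QuotientFormula K using (Θ)
  open CommutativeRing K
  open Over K
  open import Relation.Binary.Reasoning.Setoid setoid

  Θ≤ : ℕ → Alg
  Θ≤ M n w E = [ chainAlongᵇ w E ∧ boundedAlongᵇ w E M ]

  _≈ᴾ_ : Alg → Alg → Set ℓ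
  X ≈ᴾ Y = ∀ n (τ : Fin n → Fin n) → Injective _≡_ _≡_ τ → X n τ ≈ˢ Y n τ

  Θ≤-extensional : ∀ M n w → Extensional (Θ≤ M n w)
  Θ≤-extensional M n w {E} {E′} E≗E′ = reflexive (≡.cong [_]
    (≡.cong₂ _∧_ (tightAlongᵇ-cong 0 w {E} {E′} (E≗E′ ∘ w)) (boundedAlongᵇ-cong w {E} {E′} M (E≗E′ ∘ w))))

  substW-extensional : ∀ {s n} (u : Fin s → Fin n) (f : Ser s) → Extensional f → Extensional (substW u f)
  substW-extensional u f ext {E} {E′} E≗E′ rewrite supportedᵇ-cong u E≗E′ with supportedᵇ u E′
  ... | true  = ext (pullback-cong u E≗E′)
  ... | false = refl

  substW-zero : ∀ {s n} (u : Fin s → Fin n) → substW u zeroˢ ≈ˢ zeroˢ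
  substW-zero u E = trans (if-then-0 (supportedᵇ u E) 0#) (zeroʳ _)

  substW-block : ∀ {s n} (u : Fin s → Fin n) → Injective _≡_ _≡_ u → (∀ i → st u i ≡ i) → ∀ m →
    substW u (mono (λ _ → m)) ≈ˢ mono (blockExp u m)
  substW-block u inj st≡id m E = begin
    (if supportedᵇ u E then [ eqExpᵇ (pullback u E) (λ _ → m) ] else 0#)
      ≈⟨ if-then-0 (supportedᵇ u E) _ ⟩
    [ supportedᵇ u E ] * [ eqExpᵇ (pullback u E) (λ _ → m) ]
      ≈⟨ []-∧ _ _ ⟨
    [ supportedᵇ u E ∧ eqExpᵇ (pullback u E) (λ _ → m) ]
      ≡⟨ ≡.cong (λ b → [ supportedᵇ u E ∧ b ]) (allᵇ-cong (λ k → ≡.cong (_≡ᵇ m) (pullback-id k))) ⟩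
    [ supportedᵇ u E ∧ allᵇ (λ i → E (u i) ≡ᵇ m) ]
      ≡⟨ ≡.cong [_] (supported∧block≡blockExp u E m) ⟩
    mono (blockExp u m) E ∎
    where
    pullback-id : ∀ k → pullback u E k ≡ E (u k)
    pullback-id k = ≡.trans (≡.cong (pullback u E) (≡.sym (st≡id k))) (pullback-st u inj E k)

  substW-Θ≤ : ∀ M X → X ≈ᴾ Θ≤ M → ∀ {t n} (v : Fin t → Fin n) → Injective _≡_ _≡_ v → ∀ E →
    substW v (X t (st v)) E ≈ [ supportedᵇ v E ] * [ chainAlongᵇ v E ∧ boundedAlongᵇ v E M ]
  substW-Θ≤ M X X≈Θ≤ {t} v inj E = trans (if-then-0 (supportedᵇ v E) _)
    (*-congˡ (trans (X≈Θ≤ t (st v) (st-injective v inj) (pullback v E))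
                    (reflexive (≡.cong [_] (≡.cong₂ _∧_ (tightAlongᵇ-st 0 v inj E) (boundedAlongᵇ-st v inj E M))))))

  module SplitTerm (M : ℕ) (X : Alg) (X≈Θ≤ : X ≈ᴾ Θ≤ M) {n s t} (u : Fin s → Fin n) (v : Fin t → Fin n)
                   (u-inj : Injective _≡_ _≡_ u) (v-inj : Injective _≡_ _≡_ v) (partition : Partition u v) where

    rest : (Fin n → ℕ) → Bool
    rest E = chainAlongᵇ v E ∧ boundedAlongᵇ v E M

    rest-off-block : ∀ E → rest (E ∸ᵉ blockExp u (suc M)) ≡ rest E
    rest-off-block E = ≡.cong₂ _∧_ (tightAlongᵇ-cong 0 v {E ∸ᵉ blockExp u (suc M)} {E} off)
                                    (boundedAlongᵇ-cong v {E ∸ᵉ blockExp u (suc M)} {E} M off)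
      where
      off : ∀ j → E (v j) ∸ blockExp u (suc M) (v j) ≡ E (v j)
      off j = ≡.cong (E (v j) ∸_) (blockExp-off partition (suc M) j)

    term : ∀ E → (substW u (F (suc M) s (st u)) ·ˢ substW v (X t (st v))) E ≈
                 [ isIdᵇ (st u) ∧ (allᵇ (λ i → E (u i) ≡ᵇ suc M) ∧ rest E) ]
    term E with isIdᵇ (st u) in st-id
    ... | false = ·ˢ-zeroˡ _ (substW-zero u) E
    ... | true  = begin
      (substW u (mono (λ _ → suc M)) ·ˢ g) E
        ≈⟨ ·ˢ-congˡ g (substW-block u u-inj (isIdᵇ⁻ (st u) (≡true⇒T st-id)) (suc M)) E ⟩
      (mono b ·ˢ g) E
        ≈⟨ ·ˢ-monoˡ b g g-extensional E ⟩
      [ b ≤ᵉ E ] * g (E ∸ᵉ b)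
        ≈⟨ *-congˡ (substW-Θ≤ M X X≈Θ≤ v v-inj (E ∸ᵉ b)) ⟩
      [ b ≤ᵉ E ] * ([ supportedᵇ v (E ∸ᵉ b) ] * [ rest (E ∸ᵉ b) ])
        ≈⟨ trans (sym (*-assoc _ _ _)) (*-congʳ (sym ([]-∧ _ _))) ⟩
      [ (b ≤ᵉ E) ∧ supportedᵇ v (E ∸ᵉ b) ] * [ rest (E ∸ᵉ b) ]
        ≈⟨ []-∧ _ _ ⟨
      [ ((b ≤ᵉ E) ∧ supportedᵇ v (E ∸ᵉ b)) ∧ rest (E ∸ᵉ b) ]
        ≡⟨ ≡.cong [_] (≡.cong₂ _∧_ (block-split partition (suc M) E) (rest-off-block E)) ⟩
      [ allᵇ (λ i → E (u i) ≡ᵇ suc M) ∧ rest E ] ∎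
      where
      b = blockExp u (suc M)
      g = substW v (X t (st v))
      g-extensional : Extensional g
      g-extensional = substW-extensional v _ (≈ˢ-extensional (X≈Θ≤ t (st v) (st-injective v v-inj)) (Θ≤-extensional M t (st v)))

  -- Only the split after the maximal block of weights M + 1 contributes.

  module Step (M : ℕ) (X : Alg) (X≈Θ≤ : X ≈ᴾ Θ≤ M)
              {n} (σ : Fin n → Fin n) (σ-inj : Injective _≡_ _≡_ σ) (E : Fin n → ℕ) where

    L = letter σ
    V = weight σ E
    open TopBlock n M L V (letter-injective σ σ-inj) (at-≥ (E ∘ σ))

    module At (k : Fin (suc n)) where
      s = toℕ k
      s≤n : s ≤ n
      s≤n = toℕ≤pred[n] k

      prefix : Fin s → Fin n
      prefix i = inject≤ i s≤n
      suffix : Fin (n ∸ s) → Fin n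
      suffix j = cast (ℕ.m+[n∸m]≡n s≤n) (s ↑ʳ j)

      toℕ-prefix : ∀ i → toℕ (prefix i) ≡ toℕ i
      toℕ-prefix i = toℕ-inject≤ i s≤n
      toℕ-suffix : ∀ j → toℕ (suffix j) ≡ s ℕ.+ toℕ j
      toℕ-suffix j = ≡.trans (toℕ-cast _ (s ↑ʳ j)) (toℕ-↑ʳ s j)

      u = σ ∘ prefix
      v = σ ∘ suffix

      u-inj : Injective _≡_ _≡_ u
      u-inj {i} {i′} eq = toℕ-injective (≡.trans (≡.sym (toℕ-prefix i)) (≡.trans (≡.cong toℕ (σ-inj eq)) (toℕ-prefix i′)))
      v-inj : Injective _≡_ _≡_ v
      v-inj {j} {j′} eq = toℕ-injective (ℕ.+-cancelˡ-≡ s _ _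
        (≡.trans (≡.sym (toℕ-suffix j)) (≡.trans (≡.cong toℕ (σ-inj eq)) (toℕ-suffix j′))))

      partition : Partition u v
      partition = record { disjoint = disjoint ; cover = cover }
        where
        disjoint : ∀ i j → u i ≢ v j
        disjoint i j eq = ℕ.<-irrefl ≡.refl (ℕ.<-≤-trans
          (≡.subst (_< s) (≡.trans (≡.sym (toℕ-prefix i)) (≡.trans (≡.cong toℕ (σ-inj eq)) (toℕ-suffix j))) (toℕ<n i))
          (ℕ.m≤m+n s (toℕ j)))
        cover : ∀ x → (∃ λ i → u i ≡ x) ⊎ (∃ λ j → v j ≡ x)
        cover x with injective⇒surjective σ σ-inj x
        ... | q , σq≡x with toℕ q <? s
        ...   | yes q<s = inj₁ (fromℕ< q<s , ≡.trans (≡.cong σ (toℕ-injective (≡.trans (toℕ-prefix _) (toℕ-fromℕ< q<s)))) σq≡x)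
        ...   | no  q≮s = inj₂ (fromℕ< q-s< , ≡.trans (≡.cong σ (toℕ-injective (≡.trans (toℕ-suffix _)
                            (≡.trans (≡.cong (s ℕ.+_) (toℕ-fromℕ< q-s<)) (ℕ.m+[n∸m]≡n (ℕ.≮⇒≥ q≮s)))))) σq≡x)
          where q-s< = ℕ.∸-monoˡ-< (toℕ<n q) (ℕ.≮⇒≥ q≮s)

      open SplitTerm M X X≈Θ≤ u v u-inj v-inj partition public

      condition : Bool
      condition = isIdᵇ (st u) ∧ (allᵇ (λ i → E (u i) ≡ᵇ suc M) ∧ rest E)

      letter-prefix : ∀ p → p < s → letter u p ≡ L p
      letter-prefix = at-prefix (toℕ ∘ σ) prefix toℕ-prefix
      weight-prefix : ∀ p → p < s → weight u E p ≡ V p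
      weight-prefix = at-prefix (E ∘ σ) prefix toℕ-prefix
      letter-suffix : ∀ p → letter v p ≡ L (s ℕ.+ p)
      letter-suffix = at-suffix s (toℕ ∘ σ) suffix toℕ-suffix (ℕ.m+[n∸m]≡n s≤n)
      weight-suffix : ∀ p → weight v E p ≡ V (s ℕ.+ p)
      weight-suffix = at-suffix s (E ∘ σ) suffix toℕ-suffix (ℕ.m+[n∸m]≡n s≤n)

      rest-chain≡ : chainAlongᵇ v E ≡ chainᵇ (n ∸ s) (descent (n ∸ s) (λ p → L (s ℕ.+ p))) (λ p → V (s ℕ.+ p))
      rest-chain≡ = tightᵇ-cong (n ∸ s) 0
        (λ p _ → descent-cong (n ∸ s) {letter v} {λ p → L (s ℕ.+ p)}
                   (λ q _ → ≡.cong₂ _<ᵇ_ (letter-suffix (suc q)) (letter-suffix q)) p)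
        weight-suffix
      rest-bound≡ : boundedAlongᵇ v E M ≡ boundedᵇ (n ∸ s) (λ p → V (s ℕ.+ p)) M
      rest-bound≡ = boundedᵇ-cong (n ∸ s) M (λ p _ → weight-suffix p)

      condition⇒block : T condition → Block s
      condition⇒block h = record
        { top        = λ p p<s → ≡.trans (≡.sym (weight-prefix p p<s))
                         (≡.trans (at-< (E ∘ u) p p<s) (≡ᵇ⇒≡ _ _ (allᵇ⁻ _ top (fromℕ< p<s))))
        ; increasing = λ p 1+p<s → ≡.subst₂ _<_ (letter-prefix p (ℕ.<-trans (ℕ.n<1+n p) 1+p<s)) (letter-prefix (suc p) 1+p<s)
                         (st≡id⇒ascending u u-inj (isIdᵇ⁻ (st u) st-id) p 1+p<s)
        ; rest-chain = chainᵇ⁻ _ _ _ (≡.subst T rest-chain≡ (proj₁ (T-∧⁻ rest-ok)))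
        ; rest-bound = boundedᵇ⁻ _ _ M (≡.subst T rest-bound≡ (proj₂ (T-∧⁻ {chainAlongᵇ v E} rest-ok)))
        }
        where
        st-id = proj₁ (T-∧⁻ {isIdᵇ (st u)} h)
        top = proj₁ (T-∧⁻ {allᵇ (λ i → E (u i) ≡ᵇ suc M)} (proj₂ (T-∧⁻ {isIdᵇ (st u)} h)))
        rest-ok = proj₂ (T-∧⁻ {allᵇ (λ i → E (u i) ≡ᵇ suc M)} (proj₂ (T-∧⁻ {isIdᵇ (st u)} h)))

      block⇒condition : Block s → T condition
      block⇒condition b = T-∧⁺ st-id (T-∧⁺ top (T-∧⁺ rest-chain rest-bound))
        where
        open Block b renaming (top to top′; rest-chain to chain′; rest-bound to bound′)
        st-id = isIdᵇ⁺ (st u) (ascending⇒st≡id u (λ p 1+p<s →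
          ≡.subst₂ _<_ (≡.sym (letter-prefix p (ℕ.<-trans (ℕ.n<1+n p) 1+p<s))) (≡.sym (letter-prefix (suc p) 1+p<s)) (increasing p 1+p<s)))
        top = allᵇ⁺ _ (λ i → ≡⇒≡ᵇ (E (u i)) (suc M)
          (≡.trans (≡.sym (at-toℕ (E ∘ u) i)) (≡.trans (weight-prefix (toℕ i) (toℕ<n i)) (top′ (toℕ i) (toℕ<n i)))))
        rest-chain = ≡.subst T (≡.sym rest-chain≡) (chainᵇ⁺ _ _ _ chain′)
        rest-bound = ≡.subst T (≡.sym rest-bound≡) (boundedᵇ⁺ _ _ M bound′)

    F⋆X≈Θ≤ : (F (suc M) ⋆ X) n σ E ≈ Θ≤ (suc M) n σ E
    F⋆X≈Θ≤ with T? (chainAlongᵇ σ E ∧ boundedAlongᵇ σ E (suc M))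
    ... | yes ok = trans (Σᴷ-single _ k₀ others) (trans (At.term k₀ E) (reflexive (≡.trans ([]-true condition₀) (≡.sym ([]-true ok)))))
      where
      chain = proj₁ (T-∧⁻ {chainAlongᵇ σ E} ok)
      bound = proj₂ (T-∧⁻ {chainAlongᵇ σ E} ok)
      top = chain⇒block (chainᵇ⁻ n _ V chain) (boundedᵇ⁻ n V (suc M) bound)
      s = proj₁ top
      s≤n = proj₁ (proj₂ top)
      k₀ = fromℕ< (s≤s s≤n)
      toℕ-k₀ = toℕ-fromℕ< (s≤s s≤n)
      condition₀ : T (At.condition k₀)
      condition₀ = At.block⇒condition k₀ (≡.subst Block (≡.sym toℕ-k₀) (proj₂ (proj₂ top)))
      others : ∀ k → k ≢ k₀ → _
      others k k≢k₀ = trans (At.term k E) (reflexive ([]-false (λ condition → k≢k₀ (toℕ-injective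
        (≡.trans (block-unique _ s (At.s≤n k) s≤n (At.condition⇒block k condition) (proj₂ (proj₂ top))) (≡.sym toℕ-k₀))))))
    ... | no ¬ok = trans (Σᴷ-zero _ (λ k → trans (At.term k E) (reflexive ([]-false (λ cond →
                     let chain , bound = block⇒chain (At.s k) (At.s≤n k) (At.condition⇒block k cond)
                     in ¬ok (T-∧⁺ (chainᵇ⁺ n _ V chain) (boundedᵇ⁺ n V (suc M) bound)))))))
                   (reflexive (≡.sym ([]-false ¬ok)))

  F0≈Θ≤0 : F 0 ≈ᴾ Θ≤ 0
  F0≈Θ≤0 n σ σ-inj E with isIdᵇ σ in σ-id
  ... | true  = []-cong all-zero⇒ ⇒all-zero
    where
    all-zero⇒ : T (eqExpᵇ E (λ _ → 0)) → T (chainAlongᵇ σ E ∧ boundedAlongᵇ σ E 0)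
    all-zero⇒ h = T-∧⁺ (chainᵇ⁺ n _ _ chain) (boundedᵇ⁺ n _ 0 (λ p _ → ℕ.≤-reflexive (V≡0 p)))
      where
      V≡0 : ∀ p → weight σ E p ≡ 0
      V≡0 = at-map (E ∘ σ) (E ∘ σ) (λ _ _ → 0) (λ q → ≡ᵇ⇒≡ _ _ (allᵇ⁻ _ h (σ q))) (λ _ → ≡.refl)
      chain : Chain n (descent n (letter σ)) (weight σ E)
      chain p p<n rewrite V≡0 p | V≡0 (suc p)
                        | descent-ascent n (letter σ) p (id⇒ascending σ (isIdᵇ⁻ σ (≡true⇒T σ-id)) p) = z≤n
    ⇒all-zero : T (chainAlongᵇ σ E ∧ boundedAlongᵇ σ E 0) → T (eqExpᵇ E (λ _ → 0))
    ⇒all-zero h = allᵇ⁺ _ (λ x → at-image x (injective⇒surjective σ σ-inj x))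
      where
      at-image : ∀ x → (∃ λ q → σ q ≡ x) → T (E x ≡ᵇ 0)
      at-image .(σ q) (q , ≡.refl) = ≡⇒≡ᵇ (E (σ q)) 0 (ℕ.n≤0⇒n≡0 (≡.subst (_≤ 0) (at-toℕ (E ∘ σ) q)
        (boundedᵇ⁻ n (weight σ E) 0 (proj₂ (T-∧⁻ {chainAlongᵇ σ E} h)) (toℕ q) (toℕ<n q))))
  ... | false = sym (reflexive ([]-false ¬ok))
    where
    ¬ok : ¬ T (chainAlongᵇ σ E ∧ boundedAlongᵇ σ E 0)
    ¬ok h = ≡.subst T σ-id (isIdᵇ⁺ σ (ascending⇒id σ ascending))
      where
      chain = chainᵇ⁻ n (descent n (letter σ)) (weight σ E) (proj₁ (T-∧⁻ {chainAlongᵇ σ E} h))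
      bound = boundedᵇ⁻ n (weight σ E) 0 (proj₂ (T-∧⁻ {chainAlongᵇ σ E} h))
      ascending : Ascending n (letter σ)
      ascending p 1+p<n = ℕ.≤∧≢⇒< (ℕ.≮⇒≥ no-descent)
        (λ eq → ℕ.1+n≢n (≡.sym (letter-injective σ σ-inj p (suc p) p<n 1+p<n eq)))
        where
        p<n = ℕ.<-trans (ℕ.n<1+n p) 1+p<n
        no-descent : ¬ letter σ (suc p) < letter σ p
        no-descent lt = ℕ.n≮0 (ℕ.m+n≤o⇒n≤o (weight σ E (suc p)) (ℕ.≤-trans
          (≡.subst (λ d → weight σ E (suc p) ℕ.+ d ≤ weight σ E p) (descent-descent n (letter σ) p 1+p<n lt) (chain p p<n))
          (bound p p<n)))

  Fprod≈Θ≤ : ∀ M → Fprod M ≈ᴾ Θ≤ M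
  Fprod≈Θ≤ zero    = F0≈Θ≤0
  Fprod≈Θ≤ (suc M) n σ σ-inj E = Step.F⋆X≈Θ≤ M (Fprod M) (Fprod≈Θ≤ M) σ σ-inj E

  Θ≤≈Θ : ∀ n (σ : Fin n → Fin n) E M → sumℕ E ≤ M → Θ≤ M n σ E ≈ Θ n σ E
  Θ≤≈Θ n σ E M ΣE≤M = reflexive (≡.cong [_] (≡.trans (≡.cong (chainAlongᵇ σ E ∧_) (T⇒≡true (boundedᵇ⁺ n _ M bounded)))
                                                     (∧-identityʳ _)))
    where
    bounded : Bounded n (weight σ E) M
    bounded p p<n = ≡.subst (_≤ M) (≡.sym (at-< (E ∘ σ) p p<n)) (ℕ.≤-trans (≤sumℕ E (σ (fromℕ< p<n))) ΣE≤M)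

  Fprod-eventually≈Θ : ∀ n (σ : Fin n → Fin n) → Injective _≡_ _≡_ σ → ∀ E →
    ∃ λ M₀ → ∀ M → M₀ ≤ M → Fprod M n σ E ≈ Θ n σ E
  Fprod-eventually≈Θ n σ σ-inj E = sumℕ E , λ M ΣE≤M → trans (Fprod≈Θ≤ M n σ σ-inj E) (Θ≤≈Θ n σ E M ΣE≤M)

theorem5p2 : ∀ {c ℓ} (K : CommutativeRing c ℓ) → Over.IsField K → Over.CharZero K →
    let open CommutativeRing K using (_≈_)
        open Over K
    in Σ Alg λ Θ →
         (∀ n (σ : Fin n → Fin n) → Injective _≡_ _≡_ σ →
            (Θ n σ ·ˢ ΘDen σ) ≈ˢ ΘNum σ)
         × (∀ n (σ : Fin n → Fin n) → Injective _≡_ _≡_ σ →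
            ∀ (E : Fin n → ℕ) → ∃ λ M₀ → ∀ M → M₀ ≤ M → Fprod M n σ E ≈ Θ n σ E)
theorem5p2 K _ _ = Θ , Θ·den≈num , Fprod-eventually≈Θ
  where
  open QuotientFormula K using (Θ; Θ·den≈num)
  open ProductFormula K using (Fprod-eventually≈Θ)
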